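{- The coproduct $\Delta$ on $\textsf{ParSym}$ is coassociative: $(\Delta \otimes \mathrm{id}) \circ \Delta = (\mathrm{id} \otimes \Delta) \circ \Delta$.
   Context: Partition diagrams of order $k$ are set partitions of $\{1,\ldots,k,1',\ldots,k'\}$; $A_k$ is the set of them, $A_0=\{\varnothing\}$. For $\pi$ of order $k$, $\rho$ of order $l$: $\pi\otimes\rho$ (order $k+l$) has as blocks the blocks of $\pi$ and the blocks of $\rho$ shifted by $k$ ($i\mapsto i+k$, $i'\mapsto (i+k)'$). A diagram is $\otimes$-irreducible if it is not $\rho^{(1)}\otimes\rho^{(2)}$ with both factors nonempty. For nonempty $\pi,\rho$ (orders $k,l$), $\pi\bullet\rho$ is obtained from $\pi\otimes\rho$ by merging the block containing $k'$ with the block containing $(k+1)'$; $\varnothing\bullet\rho=\rho$, $\pi\bullet\varnothing=\pi$. Over a field $\mathbbm{k}$, $\textsf{ParSym}$ is the vector space with basis $\{\textsf{H}_\pi : \pi \in A_i, i \geq 0\}$ and product $\textsf{H}_\pi\textsf{H}_\rho = \textsf{H}_{\pi\otimes\rho}$, unit $\textsf{H}_\varnothing$; it is the free algebra on the $\textsf{H}_\pi$ with $\pi$ nonempty $\otimes$-irreducible. The coproduct $\Delta:\textsf{ParSym}\to\textsf{ParSym}\otimes\textsf{ParSym}$ is the algebra morphism defined on generators by $\Delta \textsf{H}_\pi = \sum \textsf{H}_{G_1}\otimes\textsf{H}_{G_2}$ for nonempty $\otimes$-irreducible $\pi$, the sum over all ordered pairs $(G_1,G_2)$ of diagrams, each either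 $\varnothing$ or $\otimes$-irreducible, with $G_1 \bullet G_2 = \pi$; and $\Delta\textsf{H}_\varnothing = \textsf{H}_\varnothing\otimes\textsf{H}_\varnothing$. -}

module Defs where

open import Level using (Level; _⊔_) renaming (suc to lsuc)
open import Data.Nat using (ℕ; zero; suc; _≡ᵇ_)
import Data.Nat as N
import Data.Nat.Properties as ℕP
open import Data.Bool using (Bool; true; false; if_then_else_; _∧_)
open import Data.Maybe using (Maybe; just; nothing)
open import Data.List using (List; []; _∷_; _++_; map; concatMap; length; [_])
import Data.List.Properties as ListP
open import Data.Vec using (Vec; []; _∷_; toList; last; head)
import Data.Vec as Vec
open import Data.Product using (Σ; Σ-syntax; _×_; _,_)
open import Data.Sum using (_⊎_)
open import Relation.Nullary using (¬_; Dec; does)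
open import Relation.Nullary.Decidable using (_×-dec_)
open import Relation.Binary.PropositionalEquality using (_≡_)
open import Algebra.Bundles using (CommutativeRing)

record Field (c ℓ : Level) : Set (lsuc (c ⊔ ℓ)) where
  field
    commutativeRing : CommutativeRing c ℓ
  open CommutativeRing commutativeRing public
  field
    0≉1     : ¬ (0# ≈ 1#)
    inverse : ∀ x → ¬ (x ≈ 0#) → Σ[ y ∈ Carrier ] (x * y ≈ 1#)

-- A diagram of order k is given by a labelling of its 2k points:
-- top i  (i = 0..k-1) is the point i+1, bot i is the point (i+1)'.
-- Two points lie in the same block iff they carry the same label.
-- Two labellings denote the same set partition iff they have the same
-- kernel; this is decided by comparing normal forms ("restricted growth
-- strings": each label is replaced by the rank of its first occurrence).

record Diagram : Set where
  constructor mkD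
  field
    order : ℕ
    top   : Vec ℕ order
    bot   : Vec ℕ order
open Diagram public

indexOf : ℕ → List ℕ → Maybe ℕ
indexOf x []       = nothing
indexOf x (y ∷ ys) = if x ≡ᵇ y then just 0 else Data.Maybe.map suc (indexOf x ys)
  where import Data.Maybe

normGo : List ℕ → List ℕ → List ℕ
normGo seen []       = []
normGo seen (x ∷ xs) with indexOf x seen
... | just i  = i ∷ normGo seen xs
... | nothing = length seen ∷ normGo (seen ++ [ x ]) xs

norm : List ℕ → List ℕ
norm = normGo []

key : Diagram → List ℕ
key π = norm (toList (top π) ++ toList (bot π))

_≈D_ : Diagram → Diagram → Set
π ≈D ρ = (order π ≡ order ρ) × (key π ≡ key ρ)

_≈D?_ : ∀ π ρ → Dec (π ≈D ρ)
π ≈D? ρ = (order π ℕP.≟ order ρ) ×-dec ListP.≡-dec ℕP._≟_ (key π) (key ρ)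

∅ : Diagram
∅ = mkD 0 [] []

IsEmpty : Diagram → Set
IsEmpty π = order π ≡ 0

NonEmpty : Diagram → Set
NonEmpty π = ¬ IsEmpty π

-- π ⊗ ρ : blocks of π, and blocks of ρ shifted by k.
-- Labels of π are made even and labels of ρ odd, so no blocks get merged.
_⊗_ : Diagram → Diagram → Diagram
mkD k t₁ b₁ ⊗ mkD l t₂ b₂ =
  mkD (k N.+ l) (Vec.map ev t₁ Vec.++ Vec.map od t₂) (Vec.map ev b₁ Vec.++ Vec.map od b₂)
  where
  ev od : ℕ → ℕ
  ev x = 2 N.* x
  od x = suc (2 N.* x)

relabel : ℕ → ℕ → Diagram → Diagram
relabel b a (mkD k t bt) = mkD k (Vec.map f t) (Vec.map f bt)
  where
  f : ℕ → ℕ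
  f x = if x ≡ᵇ b then a else x

-- π • ρ : π ⊗ ρ with the block of k' merged with the block of (k+1)';
-- ∅ • ρ = ρ and π • ∅ = π.
_•_ : Diagram → Diagram → Diagram
mkD zero t₁ b₁ • ρ = ρ
mkD (suc k) t₁ b₁ • mkD zero t₂ b₂ = mkD (suc k) t₁ b₁
mkD (suc k) t₁ b₁ • mkD (suc l) t₂ b₂ =
  relabel (suc (2 N.* head b₂)) (2 N.* last b₁) (mkD (suc k) t₁ b₁ ⊗ mkD (suc l) t₂ b₂)

Irred : Diagram → Set
Irred π = ¬ (Σ[ ρ₁ ∈ Diagram ] Σ[ ρ₂ ∈ Diagram ]
              (NonEmpty ρ₁ × NonEmpty ρ₂ × ((ρ₁ ⊗ ρ₂) ≈D π)))

-- ParSym and its tensor powers over a field, as finite formal linear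
-- combinations of basis elements H_π (resp. H_π ⊗ H_ρ, H_π ⊗ H_ρ ⊗ H_σ).
-- Equality is coefficientwise (coefficients summed over representatives
-- of the same basis element).

module ParSymOver {c ℓ} (F : Field c ℓ) where
  open Field F

  ParSym : Set c
  ParSym = List (Carrier × Diagram)

  ParSym⊗² : Set c
  ParSym⊗² = List (Carrier × Diagram × Diagram)

  ParSym⊗³ : Set c
  ParSym⊗³ = List (Carrier × Diagram × Diagram × Diagram)

  coeff₂ : ParSym⊗² → Diagram → Diagram → Carrier
  coeff₂ []                  a b = 0#
  coeff₂ ((r , x , y) ∷ s)   a b =
    (if does (x ≈D? a) ∧ does (y ≈D? b) then r else 0#) + coeff₂ s a b

  coeff₃ : ParSym⊗³ → Diagram → Diagram → Diagram → Carrier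
  coeff₃ []                    a b d = 0#
  coeff₃ ((r , x , y , z) ∷ s) a b d =
    (if does (x ≈D? a) ∧ does (y ≈D? b) ∧ does (z ≈D? d) then r else 0#) + coeff₃ s a b d

  _≈₂_ : ParSym⊗² → ParSym⊗² → Set ℓ
  s ≈₂ t = ∀ a b → coeff₂ s a b ≈ coeff₂ t a b

  _≈₃_ : ParSym⊗³ → ParSym⊗³ → Set ℓ
  s ≈₃ t = ∀ a b d → coeff₃ s a b d ≈ coeff₃ t a b d

  one₂ : ParSym⊗²
  one₂ = [ (1# , ∅ , ∅) ]

  _·₂_ : ParSym⊗² → ParSym⊗² → ParSym⊗²
  s ·₂ t = concatMap (λ { (r , a , b) →
             map (λ { (r' , a' , b') → (r * r' , a ⊗ a' , b ⊗ b') }) t }) s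

  scale₂ : Carrier → ParSym⊗² → ParSym⊗²
  scale₂ r = map (λ { (r' , a , b) → (r * r' , a , b) })

  linExt : (Diagram → ParSym⊗²) → ParSym → ParSym⊗²
  linExt D = concatMap (λ { (r , π) → scale₂ r (D π) })

  _⊗id : (Diagram → ParSym⊗²) → ParSym⊗² → ParSym⊗³
  (D ⊗id) = concatMap (λ { (r , a , b) →
              map (λ { (r' , x , y) → (r * r' , x , y , b) }) (D a) })

  id⊗_ : (Diagram → ParSym⊗²) → ParSym⊗² → ParSym⊗³
  (id⊗ D) = concatMap (λ { (r , a , b) →
              map (λ { (r' , x , y) → (r * r' , a , x , y) }) (D b) })

  GenTerm : Diagram → Diagram → Diagram → Set
  GenTerm π G₁ G₂ = (IsEmpty G₁ ⊎ Irred G₁) × (IsEmpty G₂ ⊎ Irred G₂) × ((G₁ • G₂) ≈D π)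

  -- D (values of Δ on the basis H_π) is the coproduct of the paper:
  -- well defined on basis elements, the algebra morphism
  -- (Δ H_∅ = H_∅⊗H_∅, Δ H_{π⊗ρ} = Δ H_π · Δ H_ρ) given on the generators by
  -- Δ H_π = Σ_{(G₁,G₂)} H_{G₁} ⊗ H_{G₂}  (coefficient 1 exactly on the pairs
  -- satisfying GenTerm, 0 elsewhere).
  record IsCoproduct (D : Diagram → ParSym⊗²) : Set (c ⊔ ℓ) where
    field
      wellDefined : ∀ π ρ → π ≈D ρ → D π ≈₂ D ρ
      unit        : D ∅ ≈₂ one₂
      multiplicative : ∀ π ρ → D (π ⊗ ρ) ≈₂ (D π ·₂ D ρ)
      onGenerators : ∀ π → NonEmpty π → Irred π → ∀ G₁ G₂ →
                       (GenTerm π G₁ G₂ → coeff₂ (D π) G₁ G₂ ≈ 1#)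
                     × (¬ GenTerm π G₁ G₂ → coeff₂ (D π) G₁ G₂ ≈ 0#)

{-# OPTIONS --safe #-}
-- A diagram is handled through its list of columns (label of i, label of i′), up to
-- relabelling. Then π is ⊗-irreducible iff no cut of the column list leaves two halves with
-- disjoint labels, and G₁ • G₂ ≈ π iff cutting π after |G₁| columns leaves two halves
-- sharing exactly one block, the one through the last bottom point of the left half and the
-- first bottom point of the right half. So for irreducible π, Δ H_π is the sum of H_L ⊗ H_R
-- over such "glued" cuts π = L | R with L, R irreducible or empty, and both (Δ ⊗ id) Δ H_π and
-- (id ⊗ Δ) Δ H_π count the ways of cutting π twice into three such pieces: being glued is
-- associative along consecutive cuts. As Δ, Δ ⊗ id and id ⊗ Δ are multiplicative and every
-- reducible diagram is a ⊗-product of smaller ones, induction on the order gives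
-- coassociativity on the basis, hence everywhere. A coproduct exists: the product of these
-- cut sums over the factorisation of π into irreducible consecutive blocks.
module Submission where

open import Defs
open import Algebra.Bundles using (CommutativeRing)
open import Relation.Nullary using (Dec)
open import Relation.Nullary.Decidable using (does-⇔)
open import Function.Bundles using (mk⇔)
open import Data.Product using (Σ; _×_; _,_)

module Normalisation where

  open import Data.Nat using (ℕ; zero; suc; _≡ᵇ_)
  open import Data.Nat.Properties using (≡ᵇ⇒≡; ≡⇒≡ᵇ)
  open import Data.Bool using (true; false; T)
  open import Data.Maybe using (just; nothing)
  import Data.Maybe as M
  open import Data.List using (List; []; _∷_; _++_; map; length; [_])
  open import Data.List.Properties using (map-++; length-map; ++-assoc; ++-identityʳ; map-∘; map-id-local)
  open import Function using (_∘_)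
  open import Data.List.Relation.Unary.All using (All; []; _∷_)
  open import Data.List.Relation.Unary.All.Properties using (++⁺; ++⁻ˡ; ++⁻ʳ)
  open import Data.Product using (Σ; _×_; _,_)
  open import Data.Empty using (⊥-elim)
  open import Relation.Binary.PropositionalEquality hiding ([_])

  ≡ᵇ-cong : ∀ a b c d → (a ≡ b → c ≡ d) → (c ≡ d → a ≡ b) → (a ≡ᵇ b) ≡ (c ≡ᵇ d)
  ≡ᵇ-cong a b c d p q with a ≡ᵇ b in e1 | c ≡ᵇ d in e2
  ... | true | true = refl
  ... | false | false = refl
  ... | true | false = ⊥-elim (subst T e2 (≡⇒≡ᵇ c d (p (≡ᵇ⇒≡ a b (subst T (sym e1) _)))))
  ... | false | true = ⊥-elim (subst T e1 (≡⇒≡ᵇ a b (q (≡ᵇ⇒≡ c d (subst T (sym e2) _)))))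

  LeftInverseOn : (ℕ → ℕ) → (ℕ → ℕ) → List ℕ → Set
  LeftInverseOn f g l = All (λ y → g (f y) ≡ y) l

  indexOf-map : ∀ f g x seen → g (f x) ≡ x → LeftInverseOn f g seen →
    indexOf (f x) (map f seen) ≡ indexOf x seen
  indexOf-map f g x [] gx li = refl
  indexOf-map f g x (y ∷ seen) gx (gy ∷ li)
    rewrite ≡ᵇ-cong (f x) (f y) x y (λ e → trans (sym gx) (trans (cong g e) gy)) (cong f)
          | indexOf-map f g x seen gx li = refl

  normGo-map : ∀ f g seen l → LeftInverseOn f g (seen ++ l) →
    normGo (map f seen) (map f l) ≡ normGo seen l
  normGo-map f g seen [] li = refl
  normGo-map f g seen (x ∷ l) li with ++⁻ˡ seen li | ++⁻ʳ seen li
  ... | ls | gx ∷ ll rewrite indexOf-map f g x seen gx ls with indexOf x seen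
  ... | just i = cong (i ∷_) (normGo-map f g seen l (++⁺ ls ll))
  ... | nothing = cong₂ _∷_ (length-map f seen)
        (trans (cong (λ s → normGo s (map f l)) (sym (map-++ f seen [ x ])))
               (normGo-map f g (seen ++ [ x ]) l (subst (LeftInverseOn f g) (sym (++-assoc seen [ x ] l)) li)))

  norm-map : ∀ f g l → LeftInverseOn f g l → norm (map f l) ≡ norm l
  norm-map f g l li = normGo-map f g [] l li

  seenAfter : List ℕ → List ℕ → List ℕ
  seenAfter seen [] = seen
  seenAfter seen (x ∷ xs) with indexOf x seen
  ... | just _ = seenAfter seen xs
  ... | nothing = seenAfter (seen ++ [ x ]) xs

  seenAfter-extends : ∀ seen l → Σ (List ℕ) λ e → seenAfter seen l ≡ seen ++ e
  seenAfter-extends seen [] = [] , sym (++-identityʳ seen)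
  seenAfter-extends seen (x ∷ l) with indexOf x seen
  ... | just _ = seenAfter-extends seen l
  ... | nothing with seenAfter-extends (seen ++ [ x ]) l
  ... | e , eq = x ∷ e , trans eq (++-assoc seen [ x ] e)

  ≡ᵇ-refl : ∀ x → (x ≡ᵇ x) ≡ true
  ≡ᵇ-refl zero = refl
  ≡ᵇ-refl (suc x) = ≡ᵇ-refl x

  indexOf-++-just : ∀ x s e i → indexOf x s ≡ just i → indexOf x (s ++ e) ≡ just i
  indexOf-++-just x (y ∷ s) e i eq with x ≡ᵇ y
  ... | true = eq
  ... | false with indexOf x s in e2
  ... | just j rewrite indexOf-++-just x s e j e2 = eq

  indexOf-++-new : ∀ x s e → indexOf x s ≡ nothing → indexOf x (s ++ x ∷ e) ≡ just (length s)
  indexOf-++-new x [] e eq rewrite ≡ᵇ-refl x = refl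
  indexOf-++-new x (y ∷ s) e eq with x ≡ᵇ y
  ... | false with indexOf x s in e2
  ... | nothing rewrite indexOf-++-new x s e e2 = refl

  labelAt : List ℕ → ℕ → ℕ
  labelAt [] _ = 0
  labelAt (y ∷ s) zero = y
  labelAt (y ∷ s) (suc i) = labelAt s i

  labelAt-indexOf : ∀ x S i → indexOf x S ≡ just i → labelAt S i ≡ x
  labelAt-indexOf x (y ∷ S) i eq with x ≡ᵇ y in e1
  labelAt-indexOf x (y ∷ S) zero refl | true = sym (≡ᵇ⇒≡ x y (subst T (sym e1) _))
  ... | false with indexOf x S in e2
  labelAt-indexOf x (y ∷ S) (suc i) refl | false | just .i = labelAt-indexOf x S i e2

  rank : List ℕ → ℕ → ℕ
  rank S x = M.fromMaybe 0 (indexOf x S)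

  Seen : ℕ → List ℕ → Set
  Seen x S = Σ ℕ λ i → indexOf x S ≡ just i

  normGo-rank : ∀ seen l → normGo seen l ≡ map (rank (seenAfter seen l)) l × All (λ x → Seen x (seenAfter seen l)) l
  normGo-rank seen [] = refl , []
  normGo-rank seen (x ∷ l) with indexOf x seen in e1
  ... | just i with normGo-rank seen l | seenAfter-extends seen l
  ... | (p , q) | (e , eq) =
    cong₂ _∷_ (sym (cong (M.fromMaybe 0) h)) p , (i , h) ∷ q
    where h : indexOf x (seenAfter seen l) ≡ just i
          h = trans (cong (indexOf x) eq) (indexOf-++-just x seen e i e1)
  normGo-rank seen (x ∷ l) | nothing with normGo-rank (seen ++ [ x ]) l | seenAfter-extends (seen ++ [ x ]) l
  ... | (p , q) | (e , eq) =
    cong₂ _∷_ (sym (cong (M.fromMaybe 0) h)) p , (length seen , h) ∷ q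
    where h : indexOf x (seenAfter (seen ++ [ x ]) l) ≡ just (length seen)
          h = trans (cong (indexOf x) (trans eq (++-assoc seen [ x ] e))) (indexOf-++-new x seen e e1)

  norm-relabelling : ∀ l → Σ (ℕ → ℕ) λ f → Σ (ℕ → ℕ) λ g → (map f l ≡ norm l) × LeftInverseOn f g l
  norm-relabelling l with normGo-rank [] l
  ... | p , q = rank S , labelAt S , sym p , labelAt-rank l q
    where
    S = seenAfter [] l
    labelAt-rank : ∀ l' → All (λ x → Seen x S) l' → LeftInverseOn (rank S) (labelAt S) l'
    labelAt-rank [] [] = []
    labelAt-rank (x ∷ l') ((i , h) ∷ q') =
      trans (cong (λ m → labelAt S (M.fromMaybe 0 m)) h) (labelAt-indexOf x S i h) ∷ labelAt-rank l' q'


  norm-≡⇒map : ∀ xs ys → norm xs ≡ norm ys → Σ (ℕ → ℕ) λ h → map h xs ≡ ys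
  norm-≡⇒map xs ys e with norm-relabelling xs | norm-relabelling ys
  ... | f , _ , mf , _ | f′ , g′ , mf′ , inv = g′ ∘ f , (begin
    map (g′ ∘ f) xs     ≡⟨ map-∘ xs ⟩
    map g′ (map f xs)   ≡⟨ cong (map g′) (trans mf (trans e (sym mf′))) ⟩
    map g′ (map f′ ys)  ≡⟨ map-∘ ys ⟨
    map (g′ ∘ f′) ys    ≡⟨ map-id-local inv ⟩
    ys                  ∎)
    where open ≡-Reasoning

module ColumnForm where

  open Normalisation
  open import Data.Nat using (ℕ; suc; pred)
  open import Data.List using (List; []; _∷_; _++_; map; length)
  open import Data.List.Properties using (map-++; length-map; ∷-injective; map-∘; map-id-local)
  open import Data.List.Relation.Unary.All using (All; []; _∷_)
  open import Data.Vec using (Vec; []; _∷_; toList)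
  import Data.Vec as V
  open import Data.Product using (Σ; _×_; _,_; proj₁; proj₂)
  open import Function using (_∘_)
  open import Relation.Binary.PropositionalEquality hiding ([_])

  Col : Set
  Col = ℕ × ℕ

  Cols : Set
  Cols = List Col

  mapCol : (ℕ → ℕ) → Col → Col
  mapCol f (x , y) = f x , f y

  map² : (ℕ → ℕ) → Cols → Cols
  map² f = map (mapCol f)

  labels : Cols → List ℕ
  labels cs = map proj₁ cs ++ map proj₂ cs

  Relabel : Cols → Cols → Set
  Relabel X Y = Σ (ℕ → ℕ) λ f → Σ (ℕ → ℕ) λ g → (map² f X ≡ Y) × (map² g Y ≡ X)

  ++-cancel-same-length : ∀ {A : Set} (a b c d : List A) → length a ≡ length c → a ++ b ≡ c ++ d → (a ≡ c) × (b ≡ d)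
  ++-cancel-same-length [] b [] d _ e = refl , e
  ++-cancel-same-length (x ∷ a) b (y ∷ c) d l e with ∷-injective e
  ... | refl , e' with ++-cancel-same-length a b c d (cong pred l) e'
  ... | refl , q = refl , q

  unzip-eq : ∀ (A B : Cols) → map proj₁ A ≡ map proj₁ B → map proj₂ A ≡ map proj₂ B → A ≡ B
  unzip-eq [] [] _ _ = refl
  unzip-eq ((a , b) ∷ A) ((c , d) ∷ B) e1 e2 with ∷-injective e1 | ∷-injective e2
  ... | refl , e1' | refl , e2' = cong ((a , b) ∷_) (unzip-eq A B e1' e2')

  map-fix : ∀ (h : ℕ → ℕ) l → map h l ≡ l → All (λ y → h y ≡ y) l
  map-fix h [] e = []
  map-fix h (x ∷ l) e with ∷-injective e
  ... | p , q = p ∷ map-fix h l q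

  labels-map² : ∀ f cs → labels (map² f cs) ≡ map f (labels cs)
  labels-map² f cs = trans (cong₂ _++_ (p₁ cs) (p₂ cs)) (sym (map-++ f (map proj₁ cs) (map proj₂ cs)))
    where
    p₁ : ∀ cs → map proj₁ (map² f cs) ≡ map f (map proj₁ cs)
    p₁ [] = refl
    p₁ (c ∷ cs) = cong (f (proj₁ c) ∷_) (p₁ cs)
    p₂ : ∀ cs → map proj₂ (map² f cs) ≡ map f (map proj₂ cs)
    p₂ [] = refl
    p₂ (c ∷ cs) = cong (f (proj₂ c) ∷_) (p₂ cs)

  map²-from-labels : ∀ f X Y → length X ≡ length Y → map f (labels X) ≡ labels Y → map² f X ≡ Y
  map²-from-labels f X Y l e with ++-cancel-same-length (map proj₁ (map² f X)) (map proj₂ (map² f X)) (map proj₁ Y) (map proj₂ Y)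
                          (trans (length-map proj₁ (map² f X)) (trans (length-map (mapCol f) X) (trans l (sym (length-map proj₁ Y)))))
                          (trans (labels-map² f X) e)
  ... | p , q = unzip-eq _ _ p q

  length-map² : ∀ f X → length (map² f X) ≡ length X
  length-map² f X = length-map (mapCol f) X

  norm⇒Relabel : ∀ X Y → length X ≡ length Y → norm (labels X) ≡ norm (labels Y) → Relabel X Y
  norm⇒Relabel X Y l e with norm-≡⇒map (labels X) (labels Y) e | norm-≡⇒map (labels Y) (labels X) (sym e)
  ... | h , p | h' , p' = h , h' , map²-from-labels h X Y l p , map²-from-labels h' Y X (sym l) p'

  Relabel⇒LeftInverseOn : ∀ {X Y} → (r : Relabel X Y) → LeftInverseOn (proj₁ r) (proj₁ (proj₂ r)) (labels X)
  Relabel⇒LeftInverseOn {X} {Y} (f , g , e1 , e2) = map-fix (g ∘ f) (labels X) (begin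
    map (g ∘ f) (labels X)     ≡⟨ map-∘ (labels X) ⟩
    map g (map f (labels X))   ≡⟨ cong (map g) (labels-map² f X) ⟨
    map g (labels (map² f X))  ≡⟨ cong (map g ∘ labels) e1 ⟩
    map g (labels Y)           ≡⟨ labels-map² g Y ⟨
    labels (map² g Y)          ≡⟨ cong labels e2 ⟩
    labels X                   ∎)
    where open ≡-Reasoning

  Relabel⇒norm : ∀ X Y → Relabel X Y → norm (labels X) ≡ norm (labels Y)
  Relabel⇒norm X Y r@(f , g , e1 , e2) =
    trans (sym (norm-map f g (labels X) (Relabel⇒LeftInverseOn r))) (cong norm (trans (sym (labels-map² f X)) (cong labels e1)))

  Relabel-length : ∀ {X Y} → Relabel X Y → length X ≡ length Y
  Relabel-length {X} (f , g , e1 , e2) = trans (sym (length-map² f X)) (cong length e1)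

  Relabel-refl : ∀ X → Relabel X X
  Relabel-refl X = (λ x → x) , (λ x → x) , map-id-local (all X) , map-id-local (all X)
    where
    all : ∀ X → All (λ c → mapCol (λ x → x) c ≡ c) X
    all [] = []
    all (c ∷ X) = refl ∷ all X

  Relabel-sym : ∀ {X Y} → Relabel X Y → Relabel Y X
  Relabel-sym (f , g , e1 , e2) = g , f , e2 , e1

  map²-map² : ∀ g f X → map² g (map² f X) ≡ map² (g ∘ f) X
  map²-map² g f [] = refl
  map²-map² g f (c ∷ X) = cong (_ ∷_) (map²-map² g f X)

  Relabel-trans : ∀ {X Y Z} → Relabel X Y → Relabel Y Z → Relabel X Z
  Relabel-trans {X} {Y} {Z} (f , g , e1 , e2) (f' , g' , e1' , e2') =
    (f' ∘ f) , (g ∘ g') , trans (sym (map²-map² f' f X)) (trans (cong (map² f') e1) e1')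
                        , trans (sym (map²-map² g g' Z)) (trans (cong (map² g) e2') e2)

  colsV : ∀ {n} → Vec ℕ n → Vec ℕ n → Cols
  colsV [] [] = []
  colsV (x ∷ t) (y ∷ b) = (x , y) ∷ colsV t b

  cols : Diagram → Cols
  cols (mkD n t b) = colsV t b

  length-colsV : ∀ {n} (t b : Vec ℕ n) → length (colsV t b) ≡ n
  length-colsV [] [] = refl
  length-colsV (x ∷ t) (y ∷ b) = cong suc (length-colsV t b)

  length-cols : ∀ π → length (cols π) ≡ order π
  length-cols (mkD n t b) = length-colsV t b

  labels-colsV : ∀ {n} (t b : Vec ℕ n) → labels (colsV t b) ≡ toList t ++ toList b
  labels-colsV t b = cong₂ _++_ (p₁ t b) (p₂ t b)
    where
    p₁ : ∀ {n} (t b : Vec ℕ n) → map proj₁ (colsV t b) ≡ toList t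
    p₁ [] [] = refl
    p₁ (x ∷ t) (y ∷ b) = cong (x ∷_) (p₁ t b)
    p₂ : ∀ {n} (t b : Vec ℕ n) → map proj₂ (colsV t b) ≡ toList b
    p₂ [] [] = refl
    p₂ (x ∷ t) (y ∷ b) = cong (y ∷_) (p₂ t b)

  key-cols : ∀ π → key π ≡ norm (labels (cols π))
  key-cols (mkD n t b) = cong norm (sym (labels-colsV t b))

  tops : (cs : Cols) → Vec ℕ (length cs)
  tops [] = []
  tops (c ∷ cs) = proj₁ c ∷ tops cs

  bots : (cs : Cols) → Vec ℕ (length cs)
  bots [] = []
  bots (c ∷ cs) = proj₂ c ∷ bots cs

  fromCols : Cols → Diagram
  fromCols cs = mkD (length cs) (tops cs) (bots cs)

  cols-fromCols : ∀ cs → cols (fromCols cs) ≡ cs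
  cols-fromCols [] = refl
  cols-fromCols (c ∷ cs) = cong (c ∷_) (cols-fromCols cs)

  ≈D⇒Relabel : ∀ {π ρ} → π ≈D ρ → Relabel (cols π) (cols ρ)
  ≈D⇒Relabel {π} {ρ} (o , k) = norm⇒Relabel (cols π) (cols ρ) (trans (length-cols π) (trans o (sym (length-cols ρ))))
    (trans (sym (key-cols π)) (trans k (key-cols ρ)))

  Relabel⇒≈D : ∀ {π ρ} → Relabel (cols π) (cols ρ) → π ≈D ρ
  Relabel⇒≈D {π} {ρ} r = trans (sym (length-cols π)) (trans (Relabel-length r) (length-cols ρ)) ,
    trans (key-cols π) (trans (Relabel⇒norm _ _ r) (sym (key-cols ρ)))

  ≈D-refl : ∀ π → π ≈D π
  ≈D-refl π = refl , refl

  ≈D-sym : ∀ {π ρ} → π ≈D ρ → ρ ≈D π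
  ≈D-sym (a , b) = sym a , sym b

  ≈D-trans : ∀ {π ρ σ} → π ≈D ρ → ρ ≈D σ → π ≈D σ
  ≈D-trans (a , b) (c , d) = trans a c , trans b d


module Occurrence where

  open Normalisation
  open ColumnForm
  open import Data.Nat using (ℕ; zero; suc; _+_; _≤_; _<_; z≤n; s≤s; _≟_; _<?_)
  open import Data.Nat.Properties using (+-identityʳ; <-irrefl; anyUpTo?; <⇒≤; +-cancelˡ-<)
  open import Data.List using ([]; _∷_; _++_; map; length; take; drop)
  open import Data.List.Properties using (take-map; drop-map; take++drop≡id; ++-identityʳ)
  open import Data.List.Relation.Unary.All using (All; []; _∷_)
  import Data.List.Relation.Unary.All as All
  open import Data.List.Relation.Unary.All.Properties using (++⁻ˡ; ++⁻ʳ) renaming (map⁻ to All-map⁻)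
  open import Data.Product using (Σ; _×_; _,_; proj₁; proj₂)
  open import Data.Sum using (_⊎_; inj₁; inj₂)
  open import Data.Empty using (⊥)
  open import Relation.Nullary using (Dec; yes; no; ¬?)
  open import Relation.Nullary.Decidable using (_×-dec_; _⊎-dec_; _→-dec_; map′)
  open import Function using (_∘_)
  open import Relation.Binary.PropositionalEquality hiding ([_])

  data In (x : ℕ) : Cols → Set where
    hd₁ : ∀ {b cs} → In x ((x , b) ∷ cs)
    hd₂ : ∀ {a cs} → In x ((a , x) ∷ cs)
    tl  : ∀ {c cs} → In x cs → In x (c ∷ cs)

  In? : ∀ x cs → Dec (In x cs)
  In? x [] = no λ ()
  In? x ((a , b) ∷ cs) with x ≟ a | x ≟ b | In? x cs
  ... | yes refl | _ | _ = yes hd₁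
  ... | no _ | yes refl | _ = yes hd₂
  ... | no _ | no _ | yes p = yes (tl p)
  ... | no p | no q | no r = no λ { hd₁ → p refl ; hd₂ → q refl ; (tl i) → r i }

  In-++l : ∀ {x A} B → In x A → In x (A ++ B)
  In-++l B hd₁ = hd₁
  In-++l B hd₂ = hd₂
  In-++l B (tl i) = tl (In-++l B i)

  In-++r : ∀ {x} A {B} → In x B → In x (A ++ B)
  In-++r [] i = i
  In-++r (c ∷ A) i = tl (In-++r A i)

  In-++⁻ : ∀ {x} A {B} → In x (A ++ B) → In x A ⊎ In x B
  In-++⁻ [] i = inj₂ i
  In-++⁻ (c ∷ A) hd₁ = inj₁ hd₁
  In-++⁻ (c ∷ A) hd₂ = inj₁ hd₂
  In-++⁻ (c ∷ A) (tl i) with In-++⁻ A i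
  ... | inj₁ p = inj₁ (tl p)
  ... | inj₂ p = inj₂ p

  In-map : ∀ {u} f {X} → In u X → In (f u) (map² f X)
  In-map f hd₁ = hd₁
  In-map f hd₂ = hd₂
  In-map f (tl i) = tl (In-map f i)

  In-map⁻ : ∀ {z} f X → In z (map² f X) → Σ ℕ λ u → In u X × (z ≡ f u)
  In-map⁻ f ((a , b) ∷ X) hd₁ = a , hd₁ , refl
  In-map⁻ f ((a , b) ∷ X) hd₂ = b , hd₂ , refl
  In-map⁻ f (c ∷ X) (tl i) with In-map⁻ f X i
  ... | u , p , e = u , tl p , e

  In-take : ∀ {x} j X → In x (take j X) → In x X
  In-take j X i = subst (In _) (take++drop≡id j X) (In-++l (drop j X) i)

  In-drop : ∀ {x} j X → In x (drop j X) → In x X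
  In-drop j X i = subst (In _) (take++drop≡id j X) (In-++r (take j X) i)

  LeftInverseOn-In : ∀ {f g} X → LeftInverseOn f g (labels X) → ∀ {u} → In u X → g (f u) ≡ u
  LeftInverseOn-In {f} {g} X li = both-rows X (All-map⁻ (++⁻ˡ (map proj₁ X) li)) (All-map⁻ (++⁻ʳ (map proj₁ X) li))
    where
    both-rows : ∀ X → All (λ c → g (f (proj₁ c)) ≡ proj₁ c) X → All (λ c → g (f (proj₂ c)) ≡ proj₂ c) X →
         ∀ {u} → In u X → g (f u) ≡ u
    both-rows (c ∷ X) (p ∷ ps) (q ∷ qs) hd₁ = p
    both-rows (c ∷ X) (p ∷ ps) (q ∷ qs) hd₂ = q
    both-rows (c ∷ X) (p ∷ ps) (q ∷ qs) (tl i) = both-rows X ps qs i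

  InjectiveOn : (ℕ → ℕ) → Cols → Set
  InjectiveOn f X = ∀ {u v} → In u X → In v X → f u ≡ f v → u ≡ v

  Relabel-injective : ∀ {X Y} → (r : Relabel X Y) → InjectiveOn (proj₁ r) X
  Relabel-injective {X} r@(f , g , _ , _) iu iv e = trans (sym (LeftInverseOn-In {f} {g} X (Relabel⇒LeftInverseOn r) iu))
      (trans (cong g e) (LeftInverseOn-In {f} {g} X (Relabel⇒LeftInverseOn r) iv))

  map²-cong-In : ∀ {f g} X → (∀ {z} → In z X → f z ≡ g z) → map² f X ≡ map² g X
  map²-cong-In [] h = refl
  map²-cong-In ((a , b) ∷ X) h = cong₂ _∷_ (cong₂ _,_ (h hd₁) (h hd₂)) (map²-cong-In X (h ∘ tl))

  map²-cong : ∀ {f g} X → (∀ z → f z ≡ g z) → map² f X ≡ map² g X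
  map²-cong X h = map²-cong-In X (λ {z} _ → h z)

  Disjoint : Cols → Cols → Set
  Disjoint A B = ∀ x → In x A → In x B → ⊥

  SplitsAt : ℕ → Cols → Set
  SplitsAt j X = Disjoint (take j X) (drop j X)

  NoSplit : Cols → Set
  NoSplit X = ∀ j → 0 < j → j < length X → SplitsAt j X → ⊥

  lastBottom : Cols → ℕ
  lastBottom [] = 0
  lastBottom (c ∷ []) = proj₂ c
  lastBottom (c ∷ c' ∷ cs) = lastBottom (c' ∷ cs)

  firstBottom : Cols → ℕ
  firstBottom [] = 0
  firstBottom (c ∷ cs) = proj₂ c

  SharesOnlyLast : Cols → Cols → Set
  SharesOnlyLast A B = ∀ x → In x A → In x B → x ≡ lastBottom A

  -- A ++ B are, up to relabelling, the columns of some G₁ • G₂ cut after those of G₁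
  -- (•-cut, cut-•); lastBottom [] and firstBottom [] are junk, empty halves are the first disjunct.
  Glued : Cols → Cols → Set
  Glued A B = (A ≡ [] ⊎ B ≡ []) ⊎ ((lastBottom A ≡ firstBottom B) × SharesOnlyLast A B)

  all-In? : (P : ℕ → Set) → (∀ x → Dec (P x)) → ∀ A → Dec (∀ x → In x A → P x)
  all-In? P P? [] = yes λ x ()
  all-In? P P? ((a , b) ∷ A) with P? a | P? b | all-In? P P? A
  ... | yes p | yes q | yes r = yes λ { x hd₁ → p ; x hd₂ → q ; x (tl i) → r x i }
  ... | no p | _ | _ = no λ h → p (h a hd₁)
  ... | yes _ | no q | _ = no λ h → q (h b hd₂)
  ... | yes _ | yes _ | no r = no λ h → r (λ x i → h x (tl i))

  Disjoint? : ∀ A B → Dec (Disjoint A B)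
  Disjoint? A B = all-In? (λ x → In x B → ⊥) (λ x → In? x B →-dec no λ ()) A

  SplitsAt? : ∀ j X → Dec (SplitsAt j X)
  SplitsAt? j X = Disjoint? (take j X) (drop j X)

  SharesOnlyLast? : ∀ A B → Dec (SharesOnlyLast A B)
  SharesOnlyLast? A B = all-In? (λ x → In x B → x ≡ lastBottom A) (λ x → In? x B →-dec (x ≟ lastBottom A)) A

  isNil? : ∀ (A : Cols) → Dec (A ≡ [])
  isNil? [] = yes refl
  isNil? (c ∷ A) = no λ ()

  Glued? : ∀ A B → Dec (Glued A B)
  Glued? A B = (isNil? A ⊎-dec isNil? B) ⊎-dec ((lastBottom A ≟ firstBottom B) ×-dec SharesOnlyLast? A B)

  splitPoint? : ∀ X → Dec (Σ ℕ λ j → j < length X × (0 < j × SplitsAt j X))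
  splitPoint? X = anyUpTo? (λ j → (0 <? j) ×-dec SplitsAt? j X) (length X)

  NoSplit? : ∀ X → Dec (NoSplit X)
  NoSplit? X = map′ (λ ns j p q s → ns (j , q , p , s)) (λ ns (j , q , p , s) → ns j p q s) (¬? (splitPoint? X))

  SplitsAt-map² : ∀ j f X → InjectiveOn f X → SplitsAt j X → SplitsAt j (map² f X)
  SplitsAt-map² j f X inj s z i₁ i₂
    with In-map⁻ f (take j X) (subst (In z) (take-map j X) i₁)
       | In-map⁻ f (drop j X) (subst (In z) (drop-map j X) i₂)
  ... | u , iu , e1 | v , iv , e2 with inj (In-take j X iu) (In-drop j X iv) (trans (sym e1) e2)
  ... | refl = s u iu iv

  SplitsAt-Relabel : ∀ {X Y} j → Relabel X Y → SplitsAt j X → SplitsAt j Y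
  SplitsAt-Relabel {X} {Y} j r@(f , g , e1 , e2) s = subst (SplitsAt j) e1 (SplitsAt-map² j f X (Relabel-injective r) s)

  NoSplit-Relabel : ∀ {X Y} → Relabel X Y → NoSplit X → NoSplit Y
  NoSplit-Relabel {X} {Y} r h j p q s = h j p (subst (j <_) (sym (Relabel-length r)) q) (SplitsAt-Relabel j (Relabel-sym r) s)

  lastBottom-map² : ∀ f c A → lastBottom (map² f (c ∷ A)) ≡ f (lastBottom (c ∷ A))
  lastBottom-map² f c [] = refl
  lastBottom-map² f c (c' ∷ A) = lastBottom-map² f c' A

  lastBottom-In : ∀ c A → In (lastBottom (c ∷ A)) (c ∷ A)
  lastBottom-In (a , b) [] = hd₂
  lastBottom-In c (c' ∷ A) = tl (lastBottom-In c' A)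

  firstBottom-In : ∀ c A → In (firstBottom (c ∷ A)) (c ∷ A)
  firstBottom-In (a , b) A = hd₂

  Glued-map² : ∀ f A B → InjectiveOn f (A ++ B) → Glued A B → Glued (map² f A) (map² f B)
  Glued-map² f [] B inj g = inj₁ (inj₁ refl)
  Glued-map² f (a ∷ A) [] inj g = inj₁ (inj₂ refl)
  Glued-map² f (a ∷ A) (b ∷ B) inj (inj₁ (inj₁ ()))
  Glued-map² f (a ∷ A) (b ∷ B) inj (inj₁ (inj₂ ()))
  Glued-map² f (a ∷ A) (b ∷ B) inj (inj₂ (e , h)) = inj₂ (trans (lastBottom-map² f a A) (cong f e) , h')
    where
    h' : SharesOnlyLast (map² f (a ∷ A)) (map² f (b ∷ B))
    h' z i₁ i₂ with In-map⁻ f (a ∷ A) i₁ | In-map⁻ f (b ∷ B) i₂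
    ... | u , iu , refl | v , iv , e2 with inj (In-++l (b ∷ B) iu) (In-++r (a ∷ A) iv) e2
    ... | refl = trans (cong f (h u iu iv)) (sym (lastBottom-map² f a A))

  InjectiveOn-⊆ : ∀ {f X Y} → (∀ {z} → In z Y → In z X) → InjectiveOn f X → InjectiveOn f Y
  InjectiveOn-⊆ s inj iu iv e = inj (s iu) (s iv) e

  GluedAt-Relabel : ∀ {X Y} j → Relabel X Y → Glued (take j X) (drop j X) → Glued (take j Y) (drop j Y)
  GluedAt-Relabel {X} {Y} j r@(f , g , e1 , e2) gl =
    subst (λ Z → Glued (take j Z) (drop j Z)) e1
     (subst₂ Glued (sym (take-map j X)) (sym (drop-map j X))
       (Glued-map² f (take j X) (drop j X) (InjectiveOn-⊆ (λ i → subst (In _) (take++drop≡id j X) i) (Relabel-injective r)) gl))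

  take-length-++ : ∀ (A B : Cols) → take (length A) (A ++ B) ≡ A
  take-length-++ [] B = refl
  take-length-++ (c ∷ A) B = cong (c ∷_) (take-length-++ A B)

  drop-length-++ : ∀ (A B : Cols) → drop (length A) (A ++ B) ≡ B
  drop-length-++ [] B = refl
  drop-length-++ (c ∷ A) B = drop-length-++ A B

  take-++≤ : ∀ k (A B : Cols) → k ≤ length A → take k (A ++ B) ≡ take k A
  take-++≤ zero A B _ = refl
  take-++≤ (suc k) (c ∷ A) B (s≤s p) = cong (c ∷_) (take-++≤ k A B p)

  drop-++≤ : ∀ k (A B : Cols) → k ≤ length A → drop k (A ++ B) ≡ drop k A ++ B
  drop-++≤ zero A B _ = refl
  drop-++≤ (suc k) (c ∷ A) B (s≤s p) = drop-++≤ k A B p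

  take-length-+-++ : ∀ (A : Cols) i B → take (length A + i) (A ++ B) ≡ A ++ take i B
  take-length-+-++ [] i B = refl
  take-length-+-++ (c ∷ A) i B = cong (c ∷_) (take-length-+-++ A i B)

  drop-length-+-++ : ∀ (A : Cols) i B → drop (length A + i) (A ++ B) ≡ drop i B
  drop-length-+-++ [] i B = refl
  drop-length-+-++ (c ∷ A) i B = drop-length-+-++ A i B

  data Compare (n k : ℕ) : Set where
    below : k < n → Compare n k
    equal : k ≡ n → Compare n k
    above : (i : ℕ) → k ≡ n + suc i → Compare n k

  compare-view : ∀ n k → Compare n k
  compare-view zero zero = equal refl
  compare-view zero (suc k) = above k refl
  compare-view (suc n) zero = below (s≤s z≤n)
  compare-view (suc n) (suc k) with compare-view n k
  ... | below p = below (s≤s p)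
  ... | equal e = equal (cong suc e)
  ... | above i e = above i (cong suc e)

  length-++ᶜ : ∀ (A B : Cols) → length (A ++ B) ≡ length A + length B
  length-++ᶜ [] B = refl
  length-++ᶜ (c ∷ A) B = cong suc (length-++ᶜ A B)

  NoSplit-++ : ∀ A B → Glued A B → NoSplit A → NoSplit B → NoSplit (A ++ B)
  NoSplit-++ A B gl nA nB k p q s with compare-view (length A) k
  ... | below lt = nA k p lt λ x i₁ i₂ →
          s x (subst (In x) (sym (take-++≤ k A B (<⇒≤ lt))) i₁)
              (subst (In x) (sym (drop-++≤ k A B (<⇒≤ lt))) (In-++l B i₂))
  ... | above i refl = nB (suc i) (s≤s z≤n)
          (+-cancelˡ-< (length A) (suc i) (length B) (subst (length A + suc i <_) (length-++ᶜ A B) q))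
          λ x i₁ i₂ → s x (subst (In x) (sym (take-length-+-++ A (suc i) B)) (In-++r A i₁))
                          (subst (In x) (sym (drop-length-+-++ A (suc i) B)) i₂)
  NoSplit-++ [] B gl nA nB k () q s | equal refl
  NoSplit-++ (a ∷ A) [] gl nA nB k p q s | equal refl =
    <-irrefl (sym (length-++ᶜ (a ∷ A) [])) (subst (_< length ((a ∷ A) ++ [])) (sym (+-identityʳ _)) q)
  NoSplit-++ (a ∷ A) (b ∷ B) (inj₁ (inj₁ ())) nA nB k p q s | equal refl
  NoSplit-++ (a ∷ A) (b ∷ B) (inj₁ (inj₂ ())) nA nB k p q s | equal refl
  NoSplit-++ (a ∷ A) (b ∷ B) (inj₂ (e , h)) nA nB k p q s | equal refl =
    s (lastBottom (a ∷ A)) (subst (In _) (sym (take-length-++ (a ∷ A) (b ∷ B))) (lastBottom-In a A))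
                      (subst (In _) (sym (drop-length-++ (a ∷ A) (b ∷ B))) (subst (λ z → In z (b ∷ B)) (sym e) (firstBottom-In b B)))

  lastBottom-++ : ∀ (A : Cols) b B → lastBottom (A ++ b ∷ B) ≡ lastBottom (b ∷ B)
  lastBottom-++ [] b B = refl
  lastBottom-++ (a ∷ []) b B = refl
  lastBottom-++ (a ∷ a' ∷ A) b B = lastBottom-++ (a' ∷ A) b B

  Glued-assocʳ : ∀ A B C → Glued (A ++ B) C → Glued A B → Glued A (B ++ C) × Glued B C
  Glued-assocʳ [] B C g1 g2 = inj₁ (inj₁ refl) , g1
  Glued-assocʳ (a ∷ A) [] C g1 g2 = subst (λ Z → Glued Z C) (++-identityʳ (a ∷ A)) g1 , inj₁ (inj₁ refl)
  Glued-assocʳ (a ∷ A) (b ∷ B) [] g1 g2 = subst (Glued (a ∷ A)) (sym (++-identityʳ (b ∷ B))) g2 , inj₁ (inj₂ refl)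
  Glued-assocʳ (a ∷ A) (b ∷ B) (c ∷ C) (inj₁ (inj₁ ())) g2
  Glued-assocʳ (a ∷ A) (b ∷ B) (c ∷ C) (inj₁ (inj₂ ())) g2
  Glued-assocʳ (a ∷ A) (b ∷ B) (c ∷ C) (inj₂ _) (inj₁ (inj₁ ()))
  Glued-assocʳ (a ∷ A) (b ∷ B) (c ∷ C) (inj₂ _) (inj₁ (inj₂ ()))
  Glued-assocʳ (a ∷ A) (b ∷ B) (c ∷ C) (inj₂ (e1 , h1)) (inj₂ (e2 , h2)) =
    inj₂ (e2 , k1) , inj₂ (trans (sym lb) e1 , λ x i j → trans (h1 x (In-++r (a ∷ A) i) j) lb)
    where
    lb : lastBottom ((a ∷ A) ++ b ∷ B) ≡ lastBottom (b ∷ B)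
    lb = lastBottom-++ (a ∷ A) b B
    k1 : SharesOnlyLast (a ∷ A) ((b ∷ B) ++ c ∷ C)
    k1 x i j with In-++⁻ (b ∷ B) j
    ... | inj₁ jb = h2 x i jb
    ... | inj₂ jc = h2 x i (subst (λ z → In z (b ∷ B)) (sym xe) (lastBottom-In b B))
      where xe : x ≡ lastBottom (b ∷ B)
            xe = trans (h1 x (In-++l (b ∷ B) i) jc) lb

  Glued-assocˡ : ∀ A B C → Glued A (B ++ C) → Glued B C → Glued (A ++ B) C × Glued A B
  Glued-assocˡ [] B C g1 g2 = g2 , inj₁ (inj₁ refl)
  Glued-assocˡ (a ∷ A) [] C g1 g2 = subst (λ Z → Glued Z C) (sym (++-identityʳ (a ∷ A))) g1 , inj₁ (inj₂ refl)
  Glued-assocˡ (a ∷ A) (b ∷ B) [] g1 g2 = inj₁ (inj₂ refl) , subst (Glued (a ∷ A)) (++-identityʳ (b ∷ B)) g1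
  Glued-assocˡ (a ∷ A) (b ∷ B) (c ∷ C) (inj₁ (inj₁ ())) g2
  Glued-assocˡ (a ∷ A) (b ∷ B) (c ∷ C) (inj₁ (inj₂ ())) g2
  Glued-assocˡ (a ∷ A) (b ∷ B) (c ∷ C) (inj₂ _) (inj₁ (inj₁ ()))
  Glued-assocˡ (a ∷ A) (b ∷ B) (c ∷ C) (inj₂ _) (inj₁ (inj₂ ()))
  Glued-assocˡ (a ∷ A) (b ∷ B) (c ∷ C) (inj₂ (e1 , h1)) (inj₂ (e2 , h2)) =
    inj₂ (trans lb e2 , k) , inj₂ (e1 , λ x i j → h1 x i (In-++l (c ∷ C) j))
    where
    lb : lastBottom ((a ∷ A) ++ b ∷ B) ≡ lastBottom (b ∷ B)
    lb = lastBottom-++ (a ∷ A) b B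
    k : SharesOnlyLast ((a ∷ A) ++ b ∷ B) (c ∷ C)
    k x i j with In-++⁻ (a ∷ A) i
    ... | inj₂ ib = trans (h2 x ib j) (sym lb)
    ... | inj₁ ia = trans (h2 x (subst (λ z → In z (b ∷ B)) (sym xe) (firstBottom-In b B)) j) (sym lb)
      where xe : x ≡ firstBottom (b ∷ B)
            xe = trans (h1 x ia (In-++r (b ∷ B) j)) e1


module ColumnsOfProducts where

  open Normalisation
  open ColumnForm
  open Occurrence
  open import Data.Nat using (ℕ; zero; suc; _≡ᵇ_; _+_; _*_; _≤_; _<_; s≤s; _≟_)
  open import Data.Nat.Properties using (+-suc; +-identityʳ; <-irrefl; ≡ᵇ⇒≡; n≢0⇒n>0; m<m+n; <⇒≤)
  open import Data.Bool using (Bool; true; false; if_then_else_; T)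
  open import Data.List using ([]; _∷_; _++_; map; length; take; drop)
  open import Data.List.Properties using (map-++; take-map; drop-map; take++drop≡id; ++-identityʳ)
  open import Data.Vec using (Vec; []; _∷_)
  import Data.Vec as V
  open import Data.Product using (_×_; _,_)
  open import Data.Sum using (_⊎_; inj₁; inj₂)
  open import Data.Empty using (⊥; ⊥-elim)
  open import Relation.Nullary using (Dec; yes; no; does)
  open import Function using (_∘_)
  open import Relation.Binary.PropositionalEquality hiding ([_])

  ev od half : ℕ → ℕ
  ev x = 2 * x
  od x = suc (2 * x)
  half zero = zero
  half (suc zero) = zero
  half (suc (suc n)) = suc (half n)

  even? : ℕ → Bool
  even? zero = true
  even? (suc zero) = false
  even? (suc (suc n)) = even? n

  ev-suc : ∀ x → ev (suc x) ≡ suc (suc (ev x))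
  ev-suc x = cong suc (+-suc x (x + 0))

  half-ev : ∀ x → half (ev x) ≡ x
  half-ev zero = refl
  half-ev (suc x) = trans (cong half (ev-suc x)) (cong suc (half-ev x))

  half-od : ∀ x → half (od x) ≡ x
  half-od zero = refl
  half-od (suc x) = trans (cong (half ∘ suc) (ev-suc x)) (cong suc (half-od x))

  even?-ev : ∀ x → even? (ev x) ≡ true
  even?-ev zero = refl
  even?-ev (suc x) = trans (cong even? (ev-suc x)) (even?-ev x)

  even?-od : ∀ x → even? (od x) ≡ false
  even?-od zero = refl
  even?-od (suc x) = trans (cong (even? ∘ suc) (ev-suc x)) (even?-od x)

  ev≢od : ∀ x y → ev x ≡ od y → ⊥
  ev≢od x y e with trans (sym (even?-ev x)) (trans (cong even? e) (even?-od y))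
  ... | ()

  ≡ᵇ-true : ∀ {a b} → (a ≡ᵇ b) ≡ true → a ≡ b
  ≡ᵇ-true {a} {b} e = ≡ᵇ⇒≡ a b (subst T (sym e) _)

  relabelOne : ℕ → ℕ → ℕ → ℕ
  relabelOne b a x = if x ≡ᵇ b then a else x

  relabelOne-ev : ∀ h l x → relabelOne (od h) (ev l) (ev x) ≡ ev x
  relabelOne-ev h l x with ev x ≡ᵇ od h in e
  ... | true = ⊥-elim (ev≢od x h (≡ᵇ-true e))
  ... | false = refl

  relabelOne-self : ∀ b a → relabelOne b a b ≡ a
  relabelOne-self b a rewrite ≡ᵇ-refl b = refl

  _⊗ᶜ_ : Cols → Cols → Cols
  c₁ ⊗ᶜ c₂ = map² ev c₁ ++ map² od c₂

  _•ᶜ_ : Cols → Cols → Cols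
  [] •ᶜ c₂ = c₂
  (a ∷ c₁) •ᶜ [] = a ∷ c₁
  (a ∷ c₁) •ᶜ (b ∷ c₂) = map² (relabelOne (od (firstBottom (b ∷ c₂))) (ev (lastBottom (a ∷ c₁)))) ((a ∷ c₁) ⊗ᶜ (b ∷ c₂))

  colsV-map : ∀ {n} f (t b : Vec ℕ n) → colsV (V.map f t) (V.map f b) ≡ map² f (colsV t b)
  colsV-map f [] [] = refl
  colsV-map f (x ∷ t) (y ∷ b) = cong (_ ∷_) (colsV-map f t b)

  colsV-++ : ∀ {n m} (t b : Vec ℕ n) (t' b' : Vec ℕ m) → colsV (t V.++ t') (b V.++ b') ≡ colsV t b ++ colsV t' b'
  colsV-++ [] [] t' b' = refl
  colsV-++ (x ∷ t) (y ∷ b) t' b' = cong (_ ∷_) (colsV-++ t b t' b')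

  cols-⊗ : ∀ π ρ → cols (π ⊗ ρ) ≡ cols π ⊗ᶜ cols ρ
  cols-⊗ (mkD k t b) (mkD l t' b') =
    trans (colsV-++ (V.map _ t) (V.map _ b) (V.map _ t') (V.map _ b')) (cong₂ _++_ (trans (colsV-map _ t b) (map²-cong _ λ _ → refl))
                                         (trans (colsV-map _ t' b') (map²-cong _ λ _ → refl)))

  last≡lastBottom : ∀ {k} x (t : Vec ℕ k) y (b : Vec ℕ k) → V.last (y ∷ b) ≡ lastBottom (colsV (x ∷ t) (y ∷ b))
  last≡lastBottom x [] y [] = refl
  last≡lastBottom x (x' ∷ t) y (y' ∷ b) = last≡lastBottom x' t y' b

  cols-• : ∀ G₁ G₂ → cols (G₁ • G₂) ≡ cols G₁ •ᶜ cols G₂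
  cols-• (mkD zero [] []) G₂ = refl
  cols-• (mkD (suc k) (x ∷ t) (y ∷ b)) (mkD zero [] []) = refl
  cols-• (mkD (suc k) (x ∷ t) (y ∷ b)) (mkD (suc l) (x' ∷ t') (y' ∷ b')) =
    trans (colsV-map F (V.map ev (x ∷ t) V.++ V.map od (x' ∷ t')) (V.map ev (y ∷ b) V.++ V.map od (y' ∷ b')))
     (trans (cong (map² F) (cols-⊗ (mkD (suc k) (x ∷ t) (y ∷ b)) (mkD (suc l) (x' ∷ t') (y' ∷ b'))))
       (map²-cong {F} {relabelOne (od y') (ev (lastBottom ((x , y) ∷ colsV t b)))} (((x , y) ∷ colsV t b) ⊗ᶜ ((x' , y') ∷ colsV t' b')) λ z → cong
             (λ w → if z ≡ᵇ suc (2 * y') then 2 * w else z) (last≡lastBottom x t y b)))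
    where F = relabelOne (suc (2 * y')) (2 * V.last (y ∷ b))

  map²-id : ∀ X → map² (λ x → x) X ≡ X
  map²-id [] = refl
  map²-id (c ∷ X) = cong (c ∷_) (map²-id X)

  map²-++ : ∀ f A B → map² f (A ++ B) ≡ map² f A ++ map² f B
  map²-++ f A B = map-++ (mapCol f) A B

  Relabel-map²-invertible : ∀ f g X → (∀ x → g (f x) ≡ x) → Relabel (map² f X) X
  Relabel-map²-invertible f g X h = g , f , trans (map²-map² g f X) (trans (map²-cong X h) (map²-id X)) , refl

  take-length : ∀ (X : Cols) → take (length X) X ≡ X
  take-length [] = refl
  take-length (c ∷ X) = cong (c ∷_) (take-length X)

  drop-length : ∀ (X : Cols) → drop (length X) X ≡ []
  drop-length [] = refl
  drop-length (c ∷ X) = drop-length X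

  take-++-length : ∀ (A B : Cols) n → length A ≡ n → take n (A ++ B) ≡ A
  take-++-length A B n refl = take-length-++ A B

  drop-++-length : ∀ (A B : Cols) n → length A ≡ n → drop n (A ++ B) ≡ B
  drop-++-length A B n refl = drop-length-++ A B

  parity-case : (ℕ → ℕ) → (ℕ → ℕ) → ℕ → ℕ
  parity-case f₁ f₂ w = if even? w then f₁ (half w) else f₂ (half w)

  parity-case-ev : ∀ f₁ f₂ x → parity-case f₁ f₂ (ev x) ≡ f₁ x
  parity-case-ev f₁ f₂ x rewrite even?-ev x | half-ev x = refl

  parity-case-od : ∀ f₁ f₂ x → parity-case f₁ f₂ (od x) ≡ f₂ x
  parity-case-od f₁ f₂ x rewrite even?-od x | half-od x = refl

  ⊗ᶜ-Relabel : ∀ c₁ c₂ T D → Relabel c₁ T → Relabel c₂ D → Disjoint T D → Relabel (c₁ ⊗ᶜ c₂) (T ++ D)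
  ⊗ᶜ-Relabel c₁ c₂ T D (f₁ , g₁ , e₁ , e₁') (f₂ , g₂ , e₂ , e₂') dj = F , G , fwd , bwd
    where
    F = parity-case f₁ f₂
    G : ℕ → ℕ
    G z = if does (In? z T) then ev (g₁ z) else od (g₂ z)
    fwd : map² F (c₁ ⊗ᶜ c₂) ≡ T ++ D
    fwd = trans (map²-++ F (map² ev c₁) (map² od c₂))
          (cong₂ _++_ (trans (map²-map² F ev c₁) (trans (map²-cong c₁ (parity-case-ev f₁ f₂)) e₁))
                      (trans (map²-map² F od c₂) (trans (map²-cong c₂ (parity-case-od f₁ f₂)) e₂)))
    gT : ∀ {z} → In z T → G z ≡ ev (g₁ z)
    gT {z} i with In? z T
    ... | yes _ = refl
    ... | no n = ⊥-elim (n i)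
    gD : ∀ {z} → In z D → G z ≡ od (g₂ z)
    gD {z} j with In? z T
    ... | yes i = ⊥-elim (dj z i j)
    ... | no _ = refl
    bwd : map² G (T ++ D) ≡ c₁ ⊗ᶜ c₂
    bwd = trans (map²-++ G T D)
          (cong₂ _++_ (trans (map²-cong-In T gT) (trans (sym (map²-map² ev g₁ T)) (cong (map² ev) e₁')))
                      (trans (map²-cong-In D gD) (trans (sym (map²-map² od g₂ D)) (cong (map² od) e₂'))))

  take-⊗ᶜ : ∀ c₁ c₂ → take (length c₁) (c₁ ⊗ᶜ c₂) ≡ map² ev c₁
  take-⊗ᶜ c₁ c₂ = take-++-length (map² ev c₁) (map² od c₂) (length c₁) (length-map² ev c₁)

  drop-⊗ᶜ : ∀ c₁ c₂ → drop (length c₁) (c₁ ⊗ᶜ c₂) ≡ map² od c₂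
  drop-⊗ᶜ c₁ c₂ = drop-++-length (map² ev c₁) (map² od c₂) (length c₁) (length-map² ev c₁)

  ⊗ᶜ-splits : ∀ c₁ c₂ → SplitsAt (length c₁) (c₁ ⊗ᶜ c₂)
  ⊗ᶜ-splits c₁ c₂ z i j with In-map⁻ ev c₁ (subst (In z) (take-⊗ᶜ c₁ c₂) i) | In-map⁻ od c₂ (subst (In z) (drop-⊗ᶜ c₁ c₂) j)
  ... | u , _ , e1 | v , _ , e2 = ev≢od u v (trans (sym e1) e2)

  length-⊗ᶜ : ∀ c₁ c₂ → length (c₁ ⊗ᶜ c₂) ≡ length c₁ + length c₂
  length-⊗ᶜ c₁ c₂ = trans (length-++ᶜ (map² ev c₁) (map² od c₂)) (cong₂ _+_ (length-map² ev c₁) (length-map² od c₂))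

  ev-inj : ∀ {x y} → ev x ≡ ev y → x ≡ y
  ev-inj {x} {y} e = trans (sym (half-ev x)) (trans (cong half e) (half-ev y))

  od-inj : ∀ {x y} → od x ≡ od y → x ≡ y
  od-inj {x} {y} e = trans (sym (half-od x)) (trans (cong half e) (half-od y))

  map²-parity-•ᶜ : ∀ f₁ f₂ a c₁ b c₂ → lastBottom (map² f₁ (a ∷ c₁)) ≡ firstBottom (map² f₂ (b ∷ c₂)) →
    map² (parity-case f₁ f₂) ((a ∷ c₁) •ᶜ (b ∷ c₂)) ≡ map² f₁ (a ∷ c₁) ++ map² f₂ (b ∷ c₂)
  map²-parity-•ᶜ f₁ f₂ a c₁ b c₂ e =
    trans (map²-map² F m (A ⊗ᶜ B)) (trans (map²-++ (F ∘ m) (map² ev A) (map² od B))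
      (cong₂ _++_ (trans (map²-map² (F ∘ m) ev A) (map²-cong A F-ev))
                  (trans (map²-map² (F ∘ m) od B) (map²-cong B F-od))))
    where
    A = a ∷ c₁
    B = b ∷ c₂
    lb = lastBottom A
    hb = firstBottom B
    m = relabelOne (od hb) (ev lb)
    F = parity-case f₁ f₂
    F-ev : ∀ x → F (m (ev x)) ≡ f₁ x
    F-ev x rewrite relabelOne-ev hb lb x = parity-case-ev f₁ f₂ x
    F-od : ∀ y → F (m (od y)) ≡ f₂ y
    F-od y with od y ≡ᵇ od hb in q
    ... | true = trans (parity-case-ev f₁ f₂ lb) (trans (sym (lastBottom-map² f₁ a c₁)) (trans e (cong f₂ (sym (od-inj (≡ᵇ-true q))))))
    ... | false = parity-case-od f₁ f₂ y

  •ᶜ-Relabel : ∀ c₁ c₂ T D → Relabel c₁ T → Relabel c₂ D → Glued T D → Relabel (c₁ •ᶜ c₂) (T ++ D)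
  •ᶜ-Relabel [] c₂ T D (f₁ , g₁ , e₁ , e₁') r₂ gl = subst (λ Z → Relabel c₂ (Z ++ D)) e₁ r₂
  •ᶜ-Relabel (a ∷ c₁) [] T D r₁ (f₂ , g₂ , e₂ , e₂') gl =
    subst (λ Z → Relabel (a ∷ c₁) (T ++ Z)) e₂ (subst (Relabel (a ∷ c₁)) (sym (++-identityʳ T)) r₁)
  •ᶜ-Relabel (a ∷ c₁) (b ∷ c₂) T D r₁@(f₁ , g₁ , refl , e₁') r₂@(f₂ , g₂ , refl , e₂') (inj₁ (inj₁ ()))
  •ᶜ-Relabel (a ∷ c₁) (b ∷ c₂) T D r₁@(f₁ , g₁ , refl , e₁') r₂@(f₂ , g₂ , refl , e₂') (inj₁ (inj₂ ()))
  •ᶜ-Relabel (a ∷ c₁) (b ∷ c₂) T D r₁@(f₁ , g₁ , refl , e₁') r₂@(f₂ , g₂ , refl , e₂') (inj₂ (e , h)) =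
    parity-case f₁ f₂ , G , map²-parity-•ᶜ f₁ f₂ a c₁ b c₂ e , bwd
    where
    A = a ∷ c₁
    B = b ∷ c₂
    lb = lastBottom A
    hb = firstBottom B
    m = relabelOne (od hb) (ev lb)
    T' = map² f₁ A
    D' = map² f₂ B
    G : ℕ → ℕ
    G z = if does (In? z T') then ev (g₁ z) else m (od (g₂ z))
    li₁ : ∀ {u} → In u A → g₁ (f₁ u) ≡ u
    li₁ = LeftInverseOn-In {f₁} {g₁} A (Relabel⇒LeftInverseOn r₁)
    li₂ : ∀ {u} → In u B → g₂ (f₂ u) ≡ u
    li₂ = LeftInverseOn-In {f₂} {g₂} B (Relabel⇒LeftInverseOn r₂)
    gT : ∀ {z} → In z T' → G z ≡ ev (g₁ z)
    gT {z} i with In? z T'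
    ... | yes _ = refl
    ... | no n = ⊥-elim (n i)
    gD : ∀ {z} → In z D' → G z ≡ m (od (g₂ z))
    gD {z} j with In? z T'
    ... | no _ = refl
    ... | yes i = trans (cong (ev ∘ g₁) z1) (trans (cong ev (li₁ (lastBottom-In a c₁)))
                   (sym (trans (cong (m ∘ od ∘ g₂) z2) (trans (cong (m ∘ od) (li₂ (firstBottom-In b c₂))) (relabelOne-self (od hb) (ev lb))))))
      where
      z1 : z ≡ f₁ lb
      z1 = trans (h z i j) (lastBottom-map² f₁ a c₁)
      z2 : z ≡ f₂ hb
      z2 = trans z1 (trans (sym (lastBottom-map² f₁ a c₁)) e)
    bwd : map² G (T' ++ D') ≡ A •ᶜ B
    bwd = trans (map²-++ G T' D')
          (trans (cong₂ _++_ (trans (map²-cong-In T' gT) (trans (sym (map²-map² ev g₁ T')) (trans (cong (map² ev) e₁')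
                               (trans (map²-cong A (λ x → sym (relabelOne-ev hb lb x))) (sym (map²-map² m ev A))))))
                             (trans (map²-cong-In D' gD) (trans (sym (map²-map² (m ∘ od) g₂ D')) (trans (cong (map² (m ∘ od)) e₂')
                               (sym (map²-map² m od B))))))
            (sym (map²-++ m (map² ev A) (map² od B))))

  •ᶜ-halves : ∀ c₁ c₂ → Relabel (take (length c₁) (c₁ •ᶜ c₂)) c₁ × Relabel (drop (length c₁) (c₁ •ᶜ c₂)) c₂
                        × Glued (take (length c₁) (c₁ •ᶜ c₂)) (drop (length c₁) (c₁ •ᶜ c₂))
  •ᶜ-halves [] c₂ = Relabel-refl [] , Relabel-refl c₂ , inj₁ (inj₁ refl)
  •ᶜ-halves (a ∷ c₁) [] = subst (λ Z → Relabel Z (a ∷ c₁)) (sym (take-length (a ∷ c₁))) (Relabel-refl _) ,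
                        subst (λ Z → Relabel Z []) (sym (drop-length (a ∷ c₁))) (Relabel-refl []) ,
                        inj₁ (inj₂ (drop-length (a ∷ c₁)))
  •ᶜ-halves (a ∷ c₁) (b ∷ c₂) =
    subst (λ Z → Relabel Z A) (sym tk) (Relabel-map²-invertible (m ∘ ev) half A λ x → trans (cong half (relabelOne-ev hb lb x)) (half-ev x)) ,
    subst (λ Z → Relabel Z B) (sym dr) (Relabel-map²-invertible (m ∘ od) h' B hinv) ,
    subst₂ Glued (sym tk) (sym dr) gl
    where
    A = a ∷ c₁
    B = b ∷ c₂
    lb = lastBottom A
    hb = firstBottom B
    m = relabelOne (od hb) (ev lb)
    L = map² (m ∘ ev) A
    R = map² (m ∘ od) B
    split : A •ᶜ B ≡ L ++ R
    split = trans (map²-++ m (map² ev A) (map² od B)) (cong₂ _++_ (map²-map² m ev A) (map²-map² m od B))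
    tk : take (length A) (A •ᶜ B) ≡ L
    tk = trans (cong (take (length A)) split) (take-++-length L R (length A) (length-map² _ A))
    dr : drop (length A) (A •ᶜ B) ≡ R
    dr = trans (cong (drop (length A)) split) (drop-++-length L R (length A) (length-map² _ A))
    h' : ℕ → ℕ
    h' z = if z ≡ᵇ ev lb then hb else half z
    hinv : ∀ y → h' (m (od y)) ≡ y
    hinv y with od y ≡ᵇ od hb in q
    ... | true rewrite ≡ᵇ-refl (ev lb) = sym (od-inj (≡ᵇ-true q))
    ... | false with od y ≡ᵇ ev lb in q2
    ... | true = ⊥-elim (ev≢od lb y (sym (≡ᵇ-true q2)))
    ... | false = half-od y
    gl : Glued L R
    gl = inj₂ (trans (lastBottom-map² (m ∘ ev) a c₁) (trans (relabelOne-ev hb lb lb) (sym (relabelOne-self (od hb) (ev lb)))) , hh)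
      where
      hh : SharesOnlyLast L R
      hh z i j with In-map⁻ (m ∘ ev) A i | In-map⁻ (m ∘ od) B j
      ... | u , _ , e1 | v , _ , e2 with od v ≡ᵇ od hb in q
      ... | true = trans e2 (sym (trans (lastBottom-map² (m ∘ ev) a c₁) (relabelOne-ev hb lb lb)))
      ... | false = ⊥-elim (ev≢od u v (trans (sym (relabelOne-ev hb lb u)) (trans (sym e1) e2')))
        where e2' : z ≡ od v
              e2' = e2

  Relabel-take : ∀ {X Y} j → Relabel X Y → Relabel (take j X) (take j Y)
  Relabel-take {X} {Y} j (f , g , e1 , e2) =
    f , g , trans (sym (take-map j X)) (cong (take j) e1) , trans (sym (take-map j Y)) (cong (take j) e2)

  Relabel-drop : ∀ {X Y} j → Relabel X Y → Relabel (drop j X) (drop j Y)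
  Relabel-drop {X} {Y} j (f , g , e1 , e2) =
    f , g , trans (sym (drop-map j X)) (cong (drop j) e1) , trans (sym (drop-map j Y)) (cong (drop j) e2)

  length-•ᶜ : ∀ c₁ c₂ → length (c₁ •ᶜ c₂) ≡ length c₁ + length c₂
  length-•ᶜ [] c₂ = refl
  length-•ᶜ (a ∷ c₁) [] = sym (+-identityʳ _)
  length-•ᶜ (a ∷ c₁) (b ∷ c₂) = trans (length-map² _ ((a ∷ c₁) ⊗ᶜ (b ∷ c₂))) (length-⊗ᶜ (a ∷ c₁) (b ∷ c₂))

  ∣_∣ : Diagram → ℕ
  ∣ G ∣ = length (cols G)

  •-cut : ∀ G₁ G₂ σ → (G₁ • G₂) ≈D σ →
    (∣ G₁ ∣ + ∣ G₂ ∣ ≡ ∣ σ ∣) × Glued (take ∣ G₁ ∣ (cols σ)) (drop ∣ G₁ ∣ (cols σ))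
    × Relabel (cols G₁) (take ∣ G₁ ∣ (cols σ)) × Relabel (cols G₂) (drop ∣ G₁ ∣ (cols σ))
  •-cut G₁ G₂ σ eq with •ᶜ-halves (cols G₁) (cols G₂)
  ... | p₁ , p₂ , gl =
    trans (sym (length-•ᶜ (cols G₁) (cols G₂))) (Relabel-length r) ,
    GluedAt-Relabel ∣ G₁ ∣ r gl ,
    Relabel-trans (Relabel-sym p₁) (Relabel-take ∣ G₁ ∣ r) ,
    Relabel-trans (Relabel-sym p₂) (Relabel-drop ∣ G₁ ∣ r)
    where
    r : Relabel (cols G₁ •ᶜ cols G₂) (cols σ)
    r = subst (λ Z → Relabel Z (cols σ)) (cols-• G₁ G₂) (≈D⇒Relabel eq)

  cut-• : ∀ G₁ G₂ σ j → Glued (take j (cols σ)) (drop j (cols σ)) →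
    Relabel (cols G₁) (take j (cols σ)) → Relabel (cols G₂) (drop j (cols σ)) → (G₁ • G₂) ≈D σ
  cut-• G₁ G₂ σ j gl r₁ r₂ =
    Relabel⇒≈D (subst (λ Z → Relabel Z (cols σ)) (sym (cols-• G₁ G₂))
             (subst (Relabel (cols G₁ •ᶜ cols G₂)) (take++drop≡id j (cols σ))
               (•ᶜ-Relabel (cols G₁) (cols G₂) _ _ r₁ r₂ gl)))

  NoSplit⇒Irred : ∀ π → NoSplit (cols π) → Irred π
  NoSplit⇒Irred π ns (ρ₁ , ρ₂ , n₁ , n₂ , eq) =
    ns (length c₁) (n≢0⇒n>0 λ e → n₁ (trans (sym (length-cols ρ₁)) e))
       (subst (length c₁ <_) (trans (sym (length-⊗ᶜ c₁ c₂)) (Relabel-length r))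
             (m<m+n (length c₁) (n≢0⇒n>0 λ e → n₂ (trans (sym (length-cols ρ₂)) e))))
       (SplitsAt-Relabel (length c₁) r (⊗ᶜ-splits c₁ c₂))
    where
    c₁ = cols ρ₁
    c₂ = cols ρ₂
    r : Relabel (c₁ ⊗ᶜ c₂) (cols π)
    r = subst (λ Z → Relabel Z (cols π)) (cols-⊗ ρ₁ ρ₂) (≈D⇒Relabel eq)

  length-take≤ : ∀ j (X : Cols) → j ≤ length X → length (take j X) ≡ j
  length-take≤ zero X _ = refl
  length-take≤ (suc j) (c ∷ X) (s≤s p) = cong suc (length-take≤ j X p)

  splitsAt⇒⊗ : ∀ π j → j < length (cols π) → SplitsAt j (cols π) → (fromCols (take j (cols π)) ⊗ fromCols (drop j (cols π))) ≈D π
  splitsAt⇒⊗ π j q s = Relabel⇒≈D {fromCols A ⊗ fromCols B} {π}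
      (subst (λ Z → Relabel Z cs) (sym (trans (cols-⊗ (fromCols A) (fromCols B)) (cong₂ _⊗ᶜ_ (cols-fromCols A) (cols-fromCols B))))
            (subst (Relabel (A ⊗ᶜ B)) (take++drop≡id j cs) (⊗ᶜ-Relabel A B A B (Relabel-refl A) (Relabel-refl B) s)))
    where
    cs = cols π
    A = take j cs
    B = drop j cs

  Irred⇒NoSplit : ∀ π → Irred π → NoSplit (cols π)
  Irred⇒NoSplit π irr j p q s = irr (fromCols A , fromCols B , ne1 , ne2 , splitsAt⇒⊗ π j q s)
    where
    cs = cols π
    A = take j cs
    B = drop j cs
    lA : length A ≡ j
    lA = length-take≤ j cs (<⇒≤ q)
    ne1 : NonEmpty (fromCols A)
    ne1 e = <-irrefl (sym (trans (sym lA) e)) p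
    ne2 : NonEmpty (fromCols B)
    ne2 e = <-irrefl (sym tot) q
      where tot : length cs ≡ j
            tot = trans (cong length (sym (take++drop≡id j cs)))
                   (trans (length-++ᶜ A B) (trans (cong₂ _+_ lA e) (+-identityʳ j)))

  EmptyOrIrred : Diagram → Set
  EmptyOrIrred π = IsEmpty π ⊎ Irred π

  EmptyOrIrred⇒NoSplit : ∀ π → EmptyOrIrred π → NoSplit (cols π)
  EmptyOrIrred⇒NoSplit π (inj₁ e) j p q s with subst (j <_) (trans (length-cols π) e) q
  ... | ()
  EmptyOrIrred⇒NoSplit π (inj₂ irr) = Irred⇒NoSplit π irr

  NoSplit⇒EmptyOrIrred : ∀ π → NoSplit (cols π) → EmptyOrIrred π
  NoSplit⇒EmptyOrIrred π ns with order π ≟ 0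
  ... | yes e = inj₁ e
  ... | no _ = inj₂ (NoSplit⇒Irred π ns)

  EmptyOrIrred? : ∀ π → Dec (EmptyOrIrred π)
  EmptyOrIrred? π with NoSplit? (cols π)
  ... | yes ns = yes (NoSplit⇒EmptyOrIrred π ns)
  ... | no n = no λ e → n (EmptyOrIrred⇒NoSplit π e)


module ProductLaws where

  open ColumnForm
  open Occurrence
  open ColumnsOfProducts
  open import Data.Nat using (zero; suc; _+_; _<_; s≤s; _≟_)
  open import Data.Nat.Properties using (m+n≡0⇒m≡0; m+n≡0⇒n≡0)
  open import Data.List using ([]; _++_; length; take; drop)
  open import Data.List.Properties using (++-assoc; ++-identityʳ; ≡-dec)
  open import Data.Vec using ([])
  open import Data.Product using (_×_; _,_; proj₁)
  open import Data.Sum using (inj₁; inj₂)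
  open import Data.Empty using (⊥)
  open import Relation.Nullary using (Dec; yes; no)
  open import Relation.Nullary.Decidable using (_×-dec_)
  open import Function using (_∘_)
  open import Relation.Binary.PropositionalEquality hiding ([_])

  Disjoint-images : ∀ {f g} X Y → (∀ u v → f u ≡ g v → ⊥) → Disjoint (map² f X) (map² g Y)
  Disjoint-images {f} {g} X Y h z i j with In-map⁻ f X i | In-map⁻ g Y j
  ... | u , _ , e1 | v , _ , e2 = h u v (trans (sym e1) e2)

  Relabel-ev : ∀ X → Relabel X (map² ev X)
  Relabel-ev X = Relabel-sym (Relabel-map²-invertible ev half X half-ev)

  Relabel-od : ∀ X → Relabel X (map² od X)
  Relabel-od X = Relabel-sym (Relabel-map²-invertible od half X half-od)

  ⊗-cong : ∀ {π π' ρ ρ'} → π ≈D π' → ρ ≈D ρ' → (π ⊗ ρ) ≈D (π' ⊗ ρ')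
  ⊗-cong {π} {π'} {ρ} {ρ'} e1 e2 = Relabel⇒≈D (subst₂ Relabel (sym (cols-⊗ π ρ)) (sym (cols-⊗ π' ρ'))
    (⊗ᶜ-Relabel (cols π) (cols ρ) (map² ev (cols π')) (map² od (cols ρ'))
       (Relabel-trans (≈D⇒Relabel e1) (Relabel-ev _)) (Relabel-trans (≈D⇒Relabel e2) (Relabel-od _))
       (Disjoint-images (cols π') (cols ρ') ev≢od)))

  ⊗-assoc : ∀ x y z → ((x ⊗ y) ⊗ z) ≈D (x ⊗ (y ⊗ z))
  ⊗-assoc x y z = Relabel⇒≈D (subst₂ Relabel (sym (trans (cols-⊗ (x ⊗ y) z) (cong (_⊗ᶜ cz) (cols-⊗ x y))))
                                       (sym (trans (cols-⊗ x (y ⊗ z)) (cong (cx ⊗ᶜ_) (cols-⊗ y z))))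
     (subst (Relabel ((cx ⊗ᶜ cy) ⊗ᶜ cz)) tgt
       (⊗ᶜ-Relabel (cx ⊗ᶜ cy) cz T D inner (Relabel-trans (Relabel-od cz) (Relabel-od _)) dj)))
    where
    cx = cols x
    cy = cols y
    cz = cols z
    T = map² ev cx ++ map² od (map² ev cy)
    D = map² od (map² od cz)
    inner : Relabel (cx ⊗ᶜ cy) T
    inner = ⊗ᶜ-Relabel cx cy _ _ (Relabel-ev cx) (Relabel-trans (Relabel-ev cy) (Relabel-od _)) λ w i j →
      Disjoint-images {ev} {od ∘ ev} cx cy (λ u v e → ev≢od u (ev v) e) w i (subst (In w) (map²-map² od ev cy) j)
    dj : Disjoint T D
    dj w i j with In-++⁻ (map² ev cx) i
    ... | inj₁ i1 = Disjoint-images {ev} {od ∘ od} cx cz (λ u v e → ev≢od u (od v) e) w i1 (subst (In w) (map²-map² od od cz) j)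
    ... | inj₂ i2 = Disjoint-images {od ∘ ev} {od ∘ od} cy cz (λ u v e → ev≢od u v (od-inj e)) w
                      (subst (In w) (map²-map² od ev cy) i2) (subst (In w) (map²-map² od od cz) j)
    tgt : T ++ D ≡ cx ⊗ᶜ (cy ⊗ᶜ cz)
    tgt = trans (++-assoc (map² ev cx) _ _) (cong (map² ev cx ++_) (sym (map²-++ od (map² ev cy) (map² od cz))))

  cols-∅ : ∀ x → IsEmpty x → cols x ≡ []
  cols-∅ (mkD zero [] []) refl = refl

  IsEmpty-≈D : ∀ x y → IsEmpty x → IsEmpty y → x ≈D y
  IsEmpty-≈D x y ex ey = Relabel⇒≈D (subst₂ Relabel (sym (cols-∅ x ex)) (sym (cols-∅ y ey)) (Relabel-refl []))

  IsEmpty-resp-≈D : ∀ {x y} → x ≈D y → IsEmpty x → IsEmpty y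
  IsEmpty-resp-≈D (o , _) e = trans (sym o) e

  ⊗-identityˡ : ∀ e x → IsEmpty e → (e ⊗ x) ≈D x
  ⊗-identityˡ e x ee = Relabel⇒≈D (subst (λ Z → Relabel Z (cols x)) (sym (trans (cols-⊗ e x) (cong (_⊗ᶜ cols x) (cols-∅ e ee))))
                       (Relabel-sym (Relabel-od (cols x))))

  ⊗-identityʳ : ∀ x e → IsEmpty e → (x ⊗ e) ≈D x
  ⊗-identityʳ x e ee = Relabel⇒≈D (subst (λ Z → Relabel Z (cols x))
                        (sym (trans (cols-⊗ x e) (trans (cong (cols x ⊗ᶜ_) (cols-∅ e ee)) (++-identityʳ _))))
                       (Relabel-sym (Relabel-ev (cols x))))

  Relabel? : ∀ X Y → Dec (Relabel X Y)
  Relabel? X Y with length X ≟ length Y | ≡-dec _≟_ (norm (labels X)) (norm (labels Y))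
  ... | yes l | yes n = yes (norm⇒Relabel X Y l n)
  ... | no l | _ = no λ r → l (Relabel-length r)
  ... | yes _ | no n = no λ r → n (Relabel⇒norm X Y r)

  CutPair : Cols → Diagram → Diagram → Set
  CutPair cs a b = NoSplit (cols a) × NoSplit (cols b) × (∣ a ∣ + ∣ b ∣ ≡ length cs)
               × Glued (take ∣ a ∣ cs) (drop ∣ a ∣ cs) × Relabel (cols a) (take ∣ a ∣ cs) × Relabel (cols b) (drop ∣ a ∣ cs)

  CutPair? : ∀ cs a b → Dec (CutPair cs a b)
  CutPair? cs a b = NoSplit? (cols a) ×-dec NoSplit? (cols b) ×-dec (∣ a ∣ + ∣ b ∣ ≟ length cs)
                ×-dec Glued? _ _ ×-dec Relabel? _ _ ×-dec Relabel? _ _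

  CutPair-Relabel : ∀ {cs cs'} a b → Relabel cs cs' → CutPair cs a b → CutPair cs' a b
  CutPair-Relabel a b r (n1 , n2 , l , g , r1 , r2) =
    n1 , n2 , trans l (Relabel-length r) , GluedAt-Relabel ∣ a ∣ r g , Relabel-trans r1 (Relabel-take ∣ a ∣ r) , Relabel-trans r2
        (Relabel-drop ∣ a ∣ r)

  -- GenTerm of ParSymOver, which does not depend on the field.
  GenPair : Diagram → Diagram → Diagram → Set
  GenPair π a b = EmptyOrIrred a × EmptyOrIrred b × ((a • b) ≈D π)

  GenPair⇒CutPair : ∀ π a b → GenPair π a b → CutPair (cols π) a b
  GenPair⇒CutPair π a b (ea , eb , e) = EmptyOrIrred⇒NoSplit a ea , EmptyOrIrred⇒NoSplit b eb , •-cut a b π e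

  CutPair⇒GenPair : ∀ π a b → CutPair (cols π) a b → GenPair π a b
  CutPair⇒GenPair π a b (n1 , n2 , l , g , r1 , r2) = NoSplit⇒EmptyOrIrred a n1 , NoSplit⇒EmptyOrIrred b n2 , cut-• a b π ∣ a ∣ g r1 r2

  ≈D⇒Relabel-fromCols : ∀ X a → fromCols X ≈D a → Relabel X (cols a)
  ≈D⇒Relabel-fromCols X a e = subst (λ Z → Relabel Z (cols a)) (cols-fromCols X) (≈D⇒Relabel {fromCols X} {a} e)

  Relabel⇒≈D-fromCols : ∀ X a → Relabel X (cols a) → fromCols X ≈D a
  Relabel⇒≈D-fromCols X a r = Relabel⇒≈D {fromCols X} {a} (subst (λ Z → Relabel Z (cols a)) (sym (cols-fromCols X)) r)

  length-take< : ∀ j (X : Cols) → j < suc (length X) → length (take j X) ≡ j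
  length-take< j X (s≤s p) = length-take≤ j X p

  GenPair? : ∀ x a b → Dec (GenPair x a b)
  GenPair? x a b = EmptyOrIrred? a ×-dec EmptyOrIrred? b ×-dec ((a • b) ≈D? x)

  GenPair-empty⇒ : ∀ x a b → IsEmpty x → GenPair x a b → (∅ ≈D a) × (∅ ≈D b)
  GenPair-empty⇒ x a b ex (_ , _ , e) =
    IsEmpty-≈D ∅ a refl (trans (sym (length-cols a)) (m+n≡0⇒m≡0 ∣ a ∣ z)) ,
    IsEmpty-≈D ∅ b refl (trans (sym (length-cols b)) (m+n≡0⇒n≡0 ∣ a ∣ z))
    where
    z = trans (proj₁ (•-cut a b x e)) (trans (length-cols x) ex)

  GenPair-empty⇐ : ∀ x a b → IsEmpty x → (∅ ≈D a) × (∅ ≈D b) → GenPair x a b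
  GenPair-empty⇐ x a b ex (ea , eb) = inj₁ a0 , inj₁ b0 ,
    cut-• a b x 0 (inj₁ (inj₁ refl))
      (subst (λ Z → Relabel Z []) (sym (cols-∅ a a0)) (Relabel-refl []))
      (subst₂ Relabel (sym (cols-∅ b b0)) (sym (cols-∅ x ex)) (Relabel-refl []))
    where
    a0 = IsEmpty-resp-≈D {∅} {a} ea refl
    b0 = IsEmpty-resp-≈D {∅} {b} eb refl

module CutAssociativity where

  open ColumnForm
  open Occurrence
  open ColumnsOfProducts
  open ProductLaws
  open import Data.Nat using (ℕ; zero; suc; _+_; _≤_; s≤s; _<_)
  open import Data.Nat.Properties using (≤-refl; ≤-trans; m≤m+n; +-mono-≤; <⇒≤; m<n+m)
  open import Data.List using ([]; _∷_; _++_; length; take; drop)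
  open import Data.List.Properties using (take++drop≡id)
  open import Data.Product using (Σ; _×_; _,_; proj₁; proj₂)
  open import Relation.Nullary using (Dec)
  open import Relation.Nullary.Decidable using (_×-dec_)
  open import Relation.Binary.PropositionalEquality hiding ([_])

  take-take-+ : ∀ p q (X : Cols) → take p (take (p + q) X) ≡ take p X
  take-take-+ zero q X = refl
  take-take-+ (suc p) q [] = refl
  take-take-+ (suc p) q (c ∷ X) = cong (c ∷_) (take-take-+ p q X)

  drop-take-+ : ∀ p q (X : Cols) → drop p (take (p + q) X) ≡ take q (drop p X)
  drop-take-+ zero q X = refl
  drop-take-+ (suc p) zero [] = refl
  drop-take-+ (suc p) (suc q) [] = refl
  drop-take-+ (suc p) q (c ∷ X) = drop-take-+ p q X

  drop-drop-+ : ∀ p q (X : Cols) → drop q (drop p X) ≡ drop (p + q) X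
  drop-drop-+ zero q X = refl
  drop-drop-+ (suc p) zero [] = refl
  drop-drop-+ (suc p) (suc q) [] = refl
  drop-drop-+ (suc p) q (c ∷ X) = drop-drop-+ p q X

  take-+ : ∀ p q (X : Cols) → take (p + q) X ≡ take p X ++ take q (drop p X)
  take-+ zero q X = refl
  take-+ (suc p) zero [] = refl
  take-+ (suc p) (suc q) [] = refl
  take-+ (suc p) q (c ∷ X) = cong (c ∷_) (take-+ p q X)

  length-drop≤ : ∀ j (X : Cols) → j ≤ length X → j + length (drop j X) ≡ length X
  length-drop≤ zero X _ = refl
  length-drop≤ (suc j) (c ∷ X) (s≤s p) = cong suc (length-drop≤ j X p)

  length-take<length : ∀ j (X : Cols) → j < length X → length (take j X) < length X
  length-take<length j X j<n = subst (_< length X) (sym (length-take≤ j X (<⇒≤ j<n))) j<n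

  length-drop<length : ∀ j (X : Cols) → 0 < j → j ≤ length X → length (drop j X) < length X
  length-drop<length j X 0<j j≤n = subst (length (drop j X) <_) (length-drop≤ j X j≤n) (m<n+m _ 0<j)

  ValidCut : ℕ → Cols → Set
  ValidCut j cs = Glued (take j cs) (drop j cs) × NoSplit (take j cs) × NoSplit (drop j cs)

  -- Ways for H_a ⊗ H_b ⊗ H_d to arise in (Δ ⊗ id) Δ H_π, resp. (id ⊗ Δ) Δ H_π, where cs = cols π.
  LeftCut RightCut : Cols → Diagram → Diagram → Diagram → Set
  LeftCut cs a b d = Σ ℕ λ j → (j ≤ length cs) × ValidCut j cs × Relabel (drop j cs) (cols d) × CutPair (take j cs) a b
  RightCut cs a b d = Σ ℕ λ i → (i ≤ length cs) × ValidCut i cs × Relabel (take i cs) (cols a) × CutPair (drop i cs) b d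

  LeftCut⇒RightCut : ∀ cs a b d → LeftCut cs a b d → RightCut cs a b d
  LeftCut⇒RightCut cs a b d (j , jn , (g , nT , nD) , rD , (na , nb , l , g2 , ra , rb)) with trans l (length-take≤ j cs jn)
  ... | refl = p , ≤-trans (m≤m+n p q) jn ,
      (gA , NoSplit-Relabel ra' na , subst NoSplit (sym drop-p≡BC) (NoSplit-++ B C (proj₂ asc) (NoSplit-Relabel rb' nb) nD')) ,
               Relabel-sym ra' , (nb , NoSplit-Relabel rD nD' , lbd , gBC , rbB , rdC)
    where
    p = ∣ a ∣
    q = ∣ b ∣
    A = take p cs
    B = take q (drop p cs)
    C = drop (p + q) cs
    take-p+q≡AB : take (p + q) cs ≡ A ++ B
    take-p+q≡AB = take-+ p q cs
    drop-p≡BC : drop p cs ≡ B ++ C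
    drop-p≡BC = trans (sym (take++drop≡id q (drop p cs))) (cong (B ++_) (drop-drop-+ p q cs))
    gABC : Glued (A ++ B) C
    gABC = subst (λ Z → Glued Z C) take-p+q≡AB g
    gAB : Glued A B
    gAB = subst₂ Glued (take-take-+ p q cs) (drop-take-+ p q cs) g2
    asc = Glued-assocʳ A B C gABC gAB
    gA : Glued A (drop p cs)
    gA = subst (Glued A) (sym drop-p≡BC) (proj₁ asc)
    nD' : NoSplit C
    nD' = nD
    ra' : Relabel (cols a) A
    ra' = subst (Relabel (cols a)) (take-take-+ p q cs) ra
    rb' : Relabel (cols b) B
    rb' = subst (Relabel (cols b)) (drop-take-+ p q cs) rb
    lB : length B ≡ q
    lB = sym (Relabel-length rb')
    lbd : q + ∣ d ∣ ≡ length (drop p cs)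
    lbd = trans (cong₂ _+_ (sym lB) (sym (Relabel-length rD))) (trans (sym (length-++ᶜ B C)) (cong length (sym drop-p≡BC)))
    dq : drop q (drop p cs) ≡ C
    dq = drop-drop-+ p q cs
    gBC : Glued (take q (drop p cs)) (drop q (drop p cs))
    gBC = subst (Glued B) (sym dq) (proj₂ asc)
    rbB : Relabel (cols b) (take q (drop p cs))
    rbB = rb'
    rdC : Relabel (cols d) (drop q (drop p cs))
    rdC = subst (Relabel (cols d)) (sym dq) (Relabel-sym rD)

  RightCut⇒LeftCut : ∀ cs a b d → RightCut cs a b d → LeftCut cs a b d
  RightCut⇒LeftCut cs a b d (i , iN , (g , nA , nX) , rA , (nb , nd , l , g2 , rb , rd)) with trans (sym (length-take≤ i cs iN)) (Relabel-length rA)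
  ... | refl = p + q , pqn , (gABC' , nAB' , nC) , rDd , (NoSplit-Relabel rA nA , nb , lab , gAB' , raA , rbB)
    where
    p = ∣ a ∣
    q = ∣ b ∣
    X = drop p cs
    A = take p cs
    B = take q X
    C = drop (p + q) cs
    drop-q≡C : drop q X ≡ C
    drop-q≡C = drop-drop-+ p q cs
    take-p+q≡AB : take (p + q) cs ≡ A ++ B
    take-p+q≡AB = take-+ p q cs
    gBC : Glued B C
    gBC = subst (Glued B) drop-q≡C g2
    gA : Glued A (B ++ C)
    gA = subst (Glued A) (trans (sym (take++drop≡id q X)) (cong (B ++_) drop-q≡C)) g
    asc = Glued-assocˡ A B C gA gBC
    nB : NoSplit B
    nB = NoSplit-Relabel rb nb
    nC : NoSplit C
    nC = subst NoSplit drop-q≡C (NoSplit-Relabel rd nd)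
    qX : q ≤ length X
    qX = subst (q ≤_) l (m≤m+n q ∣ d ∣)
    pqn : p + q ≤ length cs
    pqn = subst (p + q ≤_) (length-drop≤ p cs iN) (+-mono-≤ (≤-refl {p}) qX)
    gABC' : Glued (take (p + q) cs) (drop (p + q) cs)
    gABC' = subst (λ Z → Glued Z C) (sym take-p+q≡AB) (proj₁ asc)
    nAB' : NoSplit (take (p + q) cs)
    nAB' = subst NoSplit (sym take-p+q≡AB) (NoSplit-++ A B (proj₂ asc) nA nB)
    rDd : Relabel (drop (p + q) cs) (cols d)
    rDd = subst (λ Z → Relabel Z (cols d)) drop-q≡C (Relabel-sym rd)
    lab : p + q ≡ length (take (p + q) cs)
    lab = sym (length-take≤ (p + q) cs pqn)
    gAB' : Glued (take p (take (p + q) cs)) (drop p (take (p + q) cs))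
    gAB' = subst₂ Glued (sym (take-take-+ p q cs)) (sym (drop-take-+ p q cs)) (proj₂ asc)
    raA : Relabel (cols a) (take p (take (p + q) cs))
    raA = subst (Relabel (cols a)) (sym (take-take-+ p q cs)) (Relabel-sym rA)
    rbB : Relabel (cols b) (drop p (take (p + q) cs))
    rbB = subst (Relabel (cols b)) (sym (drop-take-+ p q cs)) rb

  ValidCut? : ∀ j cs → Dec (ValidCut j cs)
  ValidCut? j cs = Glued? _ _ ×-dec NoSplit? _ ×-dec NoSplit? _


module Factorisation where

  open ColumnForm
  open Occurrence
  open ColumnsOfProducts
  open import Data.Nat using (_<_; z≤n; s≤s)
  open import Data.Nat.Properties using (m<m+n; +-comm)
  open import Data.Bool using (true; false; if_then_else_)
  open import Data.List using (List; []; _∷_; _++_; map; length; [_])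
  open import Data.List.Properties using (++-assoc; map-++)
  open import Data.List.Relation.Unary.All using (All; []; _∷_)
  import Data.List.Relation.Unary.All as All
  open import Data.Product using (_,_)
  open import Data.Sum using (_⊎_; inj₁; inj₂)
  open import Data.Empty using (⊥; ⊥-elim)
  open import Relation.Nullary using (yes; no; does)
  open import Function using (_∘_)
  open import Relation.Binary.PropositionalEquality hiding ([_])

  -- Cuts acc ++ cs at each of its split points, i.e. into its ⊗-irreducible factors.
  factors : Cols → Cols → List Cols
  factors acc [] = []
  factors acc (c ∷ r) = if does (Disjoint? (acc ++ [ c ]) r) then (acc ++ [ c ]) ∷ factors [] r else factors (acc ++ [ c ]) r

  Disjoint-⊆ : ∀ {A B A' B'} → Disjoint A B → (∀ {x} → In x A' → In x A) → (∀ {x} → In x B' → In x B) → Disjoint A' B'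
  Disjoint-⊆ d sa sb x i j = d x (sa i) (sb j)

  Disjoint-[] : ∀ A → Disjoint A []
  Disjoint-[] A x i ()

  In-++-assoc : ∀ {x} A (c : Col) B → In x ((A ++ [ c ]) ++ B) → In x (A ++ c ∷ B)
  In-++-assoc A c B i = subst (In _) (++-assoc A [ c ] B) i

  factors-++-acc : ∀ acc c X Y → Disjoint (acc ++ c ∷ X) Y → factors acc ((c ∷ X) ++ Y) ≡ factors acc (c ∷ X) ++ factors [] Y
  factors-++-acc acc c [] Y d with Disjoint? (acc ++ [ c ]) Y | Disjoint? (acc ++ [ c ]) []
  ... | yes _ | yes _ = refl
  ... | _ | no n = ⊥-elim (n (Disjoint-[] _))
  ... | no n | yes _ = ⊥-elim (n d)
  factors-++-acc acc c (c' ∷ X) Y d with Disjoint? (acc ++ [ c ]) ((c' ∷ X) ++ Y) | Disjoint? (acc ++ [ c ]) (c' ∷ X)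
  ... | yes _ | yes _ = cong ((acc ++ [ c ]) ∷_)
      (factors-++-acc [] c' X Y (Disjoint-⊆ d (In-++-assoc acc c (c' ∷ X) ∘ In-++r (acc ++ [ c ])) (λ i → i)))
  ... | no _ | no _ = trans (cong (λ Z → factors Z ((c' ∷ X) ++ Y)) refl)
                       (factors-++-acc (acc ++ [ c ]) c' X Y (Disjoint-⊆ d (In-++-assoc acc c (c' ∷ X)) (λ i → i)))
  ... | yes d1 | no n = ⊥-elim (n (Disjoint-⊆ d1 (λ i → i) (In-++l Y)))
  ... | no n | yes d2 = ⊥-elim (n λ x i j → case (In-++⁻ (c' ∷ X) j) i)
    where
    case : ∀ {x} → In x (c' ∷ X) ⊎ In x Y → In x (acc ++ [ c ]) → ⊥
    case {x} (inj₁ j) i = d2 x i j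
    case {x} (inj₂ j) i = d x (In-++-assoc acc c (c' ∷ X) (In-++l (c' ∷ X) i)) j

  factors-++ : ∀ X Y → Disjoint X Y → factors [] (X ++ Y) ≡ factors [] X ++ factors [] Y
  factors-++ [] Y d = refl
  factors-++ (c ∷ X) Y d = factors-++-acc [] c X Y d

  Disjoint-map² : ∀ f A B → InjectiveOn f (A ++ B) → Disjoint A B → Disjoint (map² f A) (map² f B)
  Disjoint-map² f A B inj d z i j with In-map⁻ f A i | In-map⁻ f B j
  ... | u , iu , e1 | v , iv , e2 with inj (In-++l B iu) (In-++r A iv) (trans (sym e1) e2)
  ... | refl = d u iu iv

  Disjoint-unmap² : ∀ f A B → Disjoint (map² f A) (map² f B) → Disjoint A B
  Disjoint-unmap² f A B d x i j = d (f x) (In-map f i) (In-map f j)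

  map²-snoc : ∀ f (acc : Cols) c → map² f acc ++ [ mapCol f c ] ≡ map² f (acc ++ [ c ])
  map²-snoc f acc c = sym (map-++ (mapCol f) acc [ c ])

  factors-map² : ∀ f acc X → InjectiveOn f (acc ++ X) → factors (map² f acc) (map² f X) ≡ map (map² f) (factors acc X)
  factors-map² f acc [] inj = refl
  factors-map² f acc (c ∷ r) inj rewrite map²-snoc f acc c with Disjoint? (map² f (acc ++ [ c ])) (map² f r) | Disjoint? (acc ++ [ c ]) r
  ... | yes _ | yes _ = cong (map² f (acc ++ [ c ]) ∷_)
      (factors-map² f [] r (InjectiveOn-⊆ (λ i → In-++-assoc acc c r (In-++r (acc ++ [ c ]) i)) inj))
  ... | no _ | no _ = factors-map² f (acc ++ [ c ]) r (InjectiveOn-⊆ (In-++-assoc acc c r) inj)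
  ... | yes d1 | no n = ⊥-elim (n (Disjoint-unmap² f _ _ d1))
  ... | no n | yes d2 = ⊥-elim (n (Disjoint-map² f (acc ++ [ c ]) r (InjectiveOn-⊆ (In-++-assoc acc c r) inj) d2))

  factors-NoSplit : ∀ acc c X → NoSplit (acc ++ c ∷ X) → factors acc (c ∷ X) ≡ [ acc ++ c ∷ X ]
  factors-NoSplit acc c [] ns with Disjoint? (acc ++ [ c ]) []
  ... | yes _ = refl
  ... | no n = ⊥-elim (n (Disjoint-[] _))
  factors-NoSplit acc c (c' ∷ X) ns with Disjoint? (acc ++ [ c ]) (c' ∷ X)
  ... | no _ = trans (factors-NoSplit (acc ++ [ c ]) c' X (subst NoSplit (sym (++-assoc acc [ c ] (c' ∷ X))) ns))
                     (cong [_] (++-assoc acc [ c ] (c' ∷ X)))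
  ... | yes d = ⊥-elim (ns k kpos klt sp)
    where
    Z = acc ++ c ∷ c' ∷ X
    A = acc ++ [ c ]
    B = c' ∷ X
    eZ : A ++ B ≡ Z
    eZ = ++-assoc acc [ c ] (c' ∷ X)
    k = length A
    kpos : 0 < k
    kpos = subst (0 <_) (sym (trans (length-++ᶜ acc [ c ]) (+-comm (length acc) 1))) (s≤s z≤n)
    klt : k < length Z
    klt = subst (k <_) (trans (sym (length-++ᶜ A B)) (cong length eZ)) (m<m+n k (s≤s z≤n))
    sp : SplitsAt k Z
    sp = subst (SplitsAt k) eZ (subst₂ Disjoint (sym (take-length-++ A B)) (sym (drop-length-++ A B)) d)

  factors-⊆ : ∀ acc X → All (λ T → ∀ {x} → In x T → In x (acc ++ X)) (factors acc X)
  factors-⊆ acc [] = []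
  factors-⊆ acc (c ∷ r) with does (Disjoint? (acc ++ [ c ]) r)
  ... | true = (λ i → In-++-assoc acc c r (In-++l r i)) ∷ All.map (λ h {x} i → In-++-assoc acc c r (In-++r (acc ++ [ c ]) (h i))) (factors-⊆ [] r)
  ... | false = All.map (λ h {x} i → In-++-assoc acc c r (h i)) (factors-⊆ (acc ++ [ c ]) r)

  factors-irreducible : ∀ π → NonEmpty π → Irred π → factors [] (cols π) ≡ [ cols π ]
  factors-irreducible π ne irr with cols π | length-cols π | Irred⇒NoSplit π irr
  ... | [] | l | _ = ⊥-elim (ne (sym l))
  ... | c ∷ X | _ | ns = factors-NoSplit [] c X ns


module FiniteSums {c ℓ} (R : CommutativeRing c ℓ) where

  open import Data.Nat using (ℕ; zero; suc; _<_)
  open import Data.Nat.Properties using (≤-refl; <-irrefl; ≤-pred; m≤n⇒m≤1+n; ≤∧≢⇒<; anyUpTo?)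
  open import Data.Bool using (Bool; true; false; if_then_else_; _∧_)
  open import Data.List using (List; []; _∷_; _++_; map; concatMap; downFrom)
  open import Data.Empty using (⊥-elim)
  open import Relation.Nullary using (¬_; Dec; yes; no; does)
  open import Relation.Unary using (Decidable)
  open import Data.Product using (_,_)
  open import Data.Maybe using (nothing)
  open import Function using (_∘_)
  import Relation.Binary.PropositionalEquality as Eq
  open import Tactic.RingSolver.Core.AlmostCommutativeRing using (fromCommutativeRing)
  import Tactic.RingSolver.NonReflective as Solver
  import Relation.Binary.Reasoning.Setoid

  open CommutativeRing R public
  open import Algebra.Properties.CommutativeSemigroup +-commutativeSemigroup public
    using () renaming (interchange to +-interchange)
  open import Algebra.Properties.CommutativeSemigroup *-commutativeSemigroup public
    using () renaming (interchange to *-interchange)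
  open Solver (fromCommutativeRing R (λ _ → nothing)) public using (solve; _⊕_; _⊜_) renaming (_⊗_ to _⊛_)

  module ≈-Reasoning = Relation.Binary.Reasoning.Setoid setoid

  ≡⇒≈ : ∀ {x y} → x Eq.≡ y → x ≈ y
  ≡⇒≈ {x} e = Eq.subst (λ z → x ≈ z) e refl

  χ : Bool → Carrier → Carrier
  χ b r = if b then r else 0#

  ∑ : ∀ {a} {X : Set a} → List X → (X → Carrier) → Carrier
  ∑ [] f = 0#
  ∑ (x ∷ xs) f = f x + ∑ xs f

  ∑-cong : ∀ {a} {X : Set a} (xs : List X) {f g : X → Carrier} → (∀ x → f x ≈ g x) → ∑ xs f ≈ ∑ xs g
  ∑-cong [] h = refl
  ∑-cong (x ∷ xs) h = +-cong (h x) (∑-cong xs h)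

  ∑-0# : ∀ {a} {X : Set a} (xs : List X) → ∑ xs (λ _ → 0#) ≈ 0#
  ∑-0# [] = refl
  ∑-0# (x ∷ xs) = trans (+-identityˡ _) (∑-0# xs)

  ∑-+ : ∀ {a} {X : Set a} (xs : List X) (f g : X → Carrier) → ∑ xs (λ x → f x + g x) ≈ ∑ xs f + ∑ xs g
  ∑-+ [] f g = sym (+-identityˡ 0#)
  ∑-+ (x ∷ xs) f g = trans (+-cong refl (∑-+ xs f g)) (+-interchange (f x) (g x) (∑ xs f) (∑ xs g))

  ∑-* : ∀ {a} {X : Set a} (xs : List X) r (f : X → Carrier) → ∑ xs (λ x → r * f x) ≈ r * ∑ xs f
  ∑-* [] r f = sym (zeroʳ r)
  ∑-* (x ∷ xs) r f = trans (+-cong refl (∑-* xs r f)) (sym (distribˡ r (f x) (∑ xs f)))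

  ∑-++ : ∀ {a} {X : Set a} (xs ys : List X) (f : X → Carrier) → ∑ (xs ++ ys) f ≈ ∑ xs f + ∑ ys f
  ∑-++ [] ys f = sym (+-identityˡ _)
  ∑-++ (x ∷ xs) ys f = trans (+-cong refl (∑-++ xs ys f)) (sym (+-assoc _ _ _))

  ∑-concatMap : ∀ {a b} {X : Set a} {Y : Set b} (g : X → List Y) (xs : List X) (f : Y → Carrier) →
                ∑ (concatMap g xs) f ≈ ∑ xs (λ x → ∑ (g x) f)
  ∑-concatMap g [] f = refl
  ∑-concatMap g (x ∷ xs) f = trans (∑-++ (g x) (concatMap g xs) f) (+-cong refl (∑-concatMap g xs f))

  ∑-map : ∀ {a b} {X : Set a} {Y : Set b} (h : X → Y) (xs : List X) (f : Y → Carrier) →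
          ∑ (map h xs) f Eq.≡ ∑ xs (f ∘ h)
  ∑-map h [] f = Eq.refl
  ∑-map h (x ∷ xs) f = Eq.cong (f (h x) +_) (∑-map h xs f)

  ∑-swap : ∀ {a b} {X : Set a} {Y : Set b} (xs : List X) (ys : List Y) (f : X → Y → Carrier) →
           ∑ xs (λ x → ∑ ys (f x)) ≈ ∑ ys (λ y → ∑ xs (λ x → f x y))
  ∑-swap [] ys f = sym (∑-0# ys)
  ∑-swap (x ∷ xs) ys f = trans (+-cong refl (∑-swap xs ys f)) (sym (∑-+ ys (f x) (λ y → ∑ xs (λ x → f x y))))

  χ-does-yes : ∀ {p} {P : Set p} (d : Dec P) → P → χ (does d) 1# ≈ 1#
  χ-does-yes (yes _) _ = refl
  χ-does-yes (no ¬p) p = ⊥-elim (¬p p)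

  χ-does-no : ∀ {p} {P : Set p} (d : Dec P) → ¬ P → χ (does d) 1# ≈ 0#
  χ-does-no (yes p) ¬p = ⊥-elim (¬p p)
  χ-does-no (no _) _ = refl

  χ-0# : ∀ b → χ b 0# ≈ 0#
  χ-0# true = refl
  χ-0# false = refl

  χ-cong : ∀ b {r s} → r ≈ s → χ b r ≈ χ b s
  χ-cong true e = e
  χ-cong false e = refl

  χ-∑ : ∀ {a} {X : Set a} b (xs : List X) (f : X → Carrier) → χ b (∑ xs f) ≈ ∑ xs (λ x → χ b (f x))
  χ-∑ true xs f = refl
  χ-∑ false xs f = sym (∑-0# xs)

  χ-* : ∀ b r s → χ b (r * s) ≈ r * χ b s
  χ-* true r s = refl
  χ-* false r s = sym (zeroʳ r)

  χ-∧ : ∀ b b' r → χ b (χ b' r) ≈ χ (b ∧ b') r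
  χ-∧ true b' r = refl
  χ-∧ false b' r = refl

  count : ∀ {p} {P : ℕ → Set p} → Decidable P → ℕ → Carrier
  count P? N = ∑ (downFrom N) (λ j → χ (does (P? j)) 1#)

  count-none : ∀ {p} {P : ℕ → Set p} (P? : Decidable P) N → (∀ j → j < N → ¬ P j) → count P? N ≈ 0#
  count-none P? zero none = refl
  count-none P? (suc N) none with P? N
  ... | yes p = ⊥-elim (none N ≤-refl p)
  ... | no _ = trans (+-identityˡ _) (count-none P? N λ j j<N → none j (m≤n⇒m≤1+n j<N))

  count-unique : ∀ {p} {P : ℕ → Set p} (P? : Decidable P) N j₀ → (∀ j → j < N → P j → j Eq.≡ j₀) →
                 P j₀ → j₀ < N → count P? N ≈ 1#
  count-unique P? (suc N) j₀ unique pj₀ j₀<1+N with P? N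
  ... | yes p = trans (+-cong refl (count-none P? N λ j j<N pj →
                  <-irrefl (Eq.trans (unique j (m≤n⇒m≤1+n j<N) pj) (Eq.sym (unique N ≤-refl p))) j<N))
                (+-identityʳ _)
  ... | no ¬p = trans (+-identityˡ _) (count-unique P? N j₀ (λ j j<N → unique j (m≤n⇒m≤1+n j<N)) pj₀ j₀<N)
    where
    j₀<N : j₀ < N
    j₀<N = ≤∧≢⇒< (≤-pred j₀<1+N) λ { Eq.refl → ¬p pj₀ }

  count-anyUpTo? : ∀ {p} {P : ℕ → Set p} (P? : Decidable P) N →
                   (∀ {i j} → i < N → j < N → P i → P j → i Eq.≡ j) → count P? N ≈ χ (does (anyUpTo? P? N)) 1#
  count-anyUpTo? P? N unique with anyUpTo? P? N
  ... | yes (j , j<N , pj) = count-unique P? N j (λ i i<N pi → unique i<N j<N pi pj) pj j<N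
  ... | no none = count-none P? N λ j j<N pj → none (j , j<N , pj)

module FormalCombinations {c ℓ} (R : CommutativeRing c ℓ) {b r} (B : Set b) (_∼_ : B → B → Set r)
    (_∼?_ : ∀ x y → Dec (x ∼ y)) (∼-refl : ∀ x → x ∼ x)
    (∼-sym : ∀ {x y} → x ∼ y → y ∼ x) (∼-trans : ∀ {x y z} → x ∼ y → y ∼ z → x ∼ z) where

  open import Level using (_⊔_)
  open import Data.Nat using (suc; _≤_; z≤n; s≤s) renaming (_+_ to _+ℕ_)
  open import Data.Nat.Properties using (≤-refl; ≤-trans; n≤1+n) renaming (+-mono-≤ to +ℕ-mono-≤)
  open import Data.Bool using (if_then_else_)
  open import Data.List using (List; []; _∷_; length)
  open import Data.Product using (_×_; _,_; proj₁; proj₂)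
  open import Data.Empty using (⊥-elim)
  open import Relation.Nullary using (¬_; yes; no; does)
  import Relation.Binary.PropositionalEquality as Eq
  open FiniteSums R

  Combination : Set (c ⊔ b)
  Combination = List (Carrier × B)

  coeff : Combination → B → Carrier
  coeff s a = ∑ s (λ e → χ (does (proj₂ e ∼? a)) (proj₁ e))

  eval : (B → Carrier) → Combination → Carrier
  eval f s = ∑ s (λ e → proj₁ e * f (proj₂ e))

  remove : B → Combination → Combination
  remove x [] = []
  remove x (e ∷ s) = if does (proj₂ e ∼? x) then remove x s else e ∷ remove x s

  Respects : (B → Carrier) → Set _
  Respects f = ∀ {x y} → x ∼ y → f x ≈ f y

  eval-remove : ∀ f → Respects f → ∀ x s → eval f s ≈ coeff s x * f x + eval f (remove x s)
  eval-remove f rf x [] = sym (trans (+-identityʳ _) (zeroˡ _))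
  eval-remove f rf x ((r , y) ∷ s) with y ∼? x
  ... | yes p = trans (+-cong (*-cong refl (rf p)) (eval-remove f rf x s)) (collect r (coeff s x) (f x) (eval f (remove x s)))
    where collect : ∀ a b c d → a * c + (b * c + d) ≈ (a + b) * c + d
          collect = solve 4 (λ a b c d → ((a ⊛ c) ⊕ ((b ⊛ c) ⊕ d)) ⊜ (((a ⊕ b) ⊛ c) ⊕ d)) refl
  ... | no p = trans (+-cong refl (eval-remove f rf x s)) (trans (bring-forward (r * f y) (coeff s x) (f x) (eval f (remove x s)))
                   (+-cong (*-cong (sym (+-identityˡ _)) refl) refl))
    where bring-forward : ∀ a b c d → a + (b * c + d) ≈ b * c + (a + d)
          bring-forward = solve 4 (λ a b c d → (a ⊕ ((b ⊛ c) ⊕ d)) ⊜ ((b ⊛ c) ⊕ (a ⊕ d))) refl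

  coeff-remove-∼ : ∀ {x a} → x ∼ a → ∀ s → coeff (remove x s) a ≈ 0#
  coeff-remove-∼ xa [] = refl
  coeff-remove-∼ {x} {a} xa ((r , y) ∷ s) with y ∼? x
  ... | yes p = coeff-remove-∼ xa s
  ... | no p with y ∼? a
  ... | yes q = ⊥-elim (p (∼-trans q (∼-sym xa)))
  ... | no q = trans (+-identityˡ _) (coeff-remove-∼ xa s)

  coeff-remove-≁ : ∀ {x a} → ¬ x ∼ a → ∀ s → coeff (remove x s) a ≈ coeff s a
  coeff-remove-≁ nxa [] = refl
  coeff-remove-≁ {x} {a} nxa ((r , y) ∷ s) with y ∼? x
  ... | no p = +-cong refl (coeff-remove-≁ nxa s)
  ... | yes p with y ∼? a
  ... | yes q = ⊥-elim (nxa (∼-trans (∼-sym p) q))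
  ... | no q = sym (trans (+-identityˡ _) (sym (coeff-remove-≁ nxa s)))

  length-remove : ∀ x s → length (remove x s) ≤ length s
  length-remove x [] = z≤n
  length-remove x ((r , y) ∷ s) with y ∼? x
  ... | yes _ = ≤-trans (length-remove x s) (n≤1+n _)
  ... | no _ = s≤s (length-remove x s)

  remove-head : ∀ r x s → remove x ((r , x) ∷ s) Eq.≡ remove x s
  remove-head r x s with x ∼? x
  ... | yes _ = Eq.refl
  ... | no n = ⊥-elim (n (∼-refl x))

  _≋_ : Combination → Combination → Set _
  s ≋ t = ∀ a → coeff s a ≈ coeff t a

  remove-cong : ∀ x s t → s ≋ t → remove x s ≋ remove x t
  remove-cong x s t e a with x ∼? a
  ... | yes p = trans (coeff-remove-∼ p s) (sym (coeff-remove-∼ p t))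
  ... | no p = trans (coeff-remove-≁ p s) (trans (e a) (sym (coeff-remove-≁ p t)))

  eval-cong-step : ∀ f → Respects f → ∀ x s t → s ≋ t → eval f (remove x s) ≈ eval f (remove x t) → eval f s ≈ eval f t
  eval-cong-step f rf x s t e h = trans (eval-remove f rf x s) (trans (+-cong (*-cong (e x) refl) h) (sym (eval-remove f rf x t)))

  -- Induction on the total length: all terms on the basis element of the first term are
  -- removed from both sides at once (eval-remove).
  eval-cong-bounded : ∀ f → Respects f → ∀ n s t → length s +ℕ length t ≤ n → s ≋ t → eval f s ≈ eval f t
  eval-cong-bounded f rf n [] [] _ _ = refl
  eval-cong-bounded f rf (suc n) ((r , x) ∷ s) t (s≤s le) e =
    eval-cong-step f rf x ((r , x) ∷ s) t e
      (Eq.subst (λ Z → eval f Z ≈ eval f (remove x t)) (Eq.sym (remove-head r x s))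
        (eval-cong-bounded f rf n (remove x s) (remove x t) (≤-trans (+ℕ-mono-≤ (length-remove x s) (length-remove x t)) le)
           (Eq.subst (λ Z → Z ≋ remove x t) (remove-head r x s) (remove-cong x ((r , x) ∷ s) t e))))
  eval-cong-bounded f rf (suc n) [] ((r , x) ∷ t) (s≤s le) e =
    eval-cong-step f rf x [] ((r , x) ∷ t) e
      (Eq.subst (λ Z → eval f [] ≈ eval f Z) (Eq.sym (remove-head r x t))
        (eval-cong-bounded f rf n [] (remove x t) (≤-trans (length-remove x t) le)
           (Eq.subst (λ Z → [] ≋ Z) (remove-head r x t) (remove-cong x [] ((r , x) ∷ t) e))))

  eval-cong : ∀ f → Respects f → ∀ {s t} → s ≋ t → eval f s ≈ eval f t
  eval-cong f rf {s} {t} e = eval-cong-bounded f rf _ s t ≤-refl e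


module Tensors {c ℓ} (F : Field c ℓ) where

  open import Relation.Binary.Bundles using (Setoid)
  import Relation.Binary.Reasoning.Setoid
  open import Data.List.Relation.Binary.Pointwise using (Pointwise; []; _∷_)
  open import Data.Bool using (Bool; true; false; _∧_)
  open import Data.List using (List; []; _∷_; _++_; map; concatMap)
  open import Data.Product using (_×_; _,_; proj₁; proj₂)
  open import Relation.Nullary using (Dec; does)
  open import Relation.Nullary.Decidable using (_×-dec_)
  import Relation.Binary.PropositionalEquality as Eq
  open ColumnForm using (≈D-refl; ≈D-sym; ≈D-trans)
  open ProductLaws using (⊗-cong; ⊗-assoc; ⊗-identityˡ; ⊗-identityʳ)

  open FiniteSums (Field.commutativeRing F) public
  open ParSymOver F public

  D² : Set
  D² = Diagram × Diagram
  _≈D²_ : D² → D² → Set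
  p ≈D² q = (proj₁ p ≈D proj₁ q) × (proj₂ p ≈D proj₂ q)
  _≈D²?_ : ∀ p q → Dec (p ≈D² q)
  p ≈D²? q = (proj₁ p ≈D? proj₁ q) ×-dec (proj₂ p ≈D? proj₂ q)

  D³ : Set
  D³ = Diagram × Diagram × Diagram
  _≈D³_ : D³ → D³ → Set
  p ≈D³ q = (proj₁ p ≈D proj₁ q) × (proj₁ (proj₂ p) ≈D proj₁ (proj₂ q)) × (proj₂ (proj₂ p) ≈D proj₂ (proj₂ q))
  _≈D³?_ : ∀ p q → Dec (p ≈D³ q)
  p ≈D³? q = (proj₁ p ≈D? proj₁ q) ×-dec (proj₁ (proj₂ p) ≈D? proj₁ (proj₂ q)) ×-dec (proj₂ (proj₂ p) ≈D? proj₂ (proj₂ q))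

  ≈D²-sym : ∀ {p q} → (p ≈D² q) → (q ≈D² p)
  ≈D²-sym {p} {q} (a , b) = ≈D-sym {proj₁ p} {proj₁ q} a , ≈D-sym {proj₂ p} {proj₂ q} b
  ≈D²-trans : ∀ {p q r} → (p ≈D² q) → (q ≈D² r) → (p ≈D² r)
  ≈D²-trans {p} {q} {r} (a , b) (a' , b') = ≈D-trans {proj₁ p} {proj₁ q} {proj₁ r} a a' , ≈D-trans {proj₂ p} {proj₂ q} {proj₂ r} b b'
  ≈D³-sym : ∀ {p q} → (p ≈D³ q) → (q ≈D³ p)
  ≈D³-sym {x , y , z} {x' , y' , z'} (a , b , d) = ≈D-sym {x} {x'} a , ≈D-sym {y} {y'} b , ≈D-sym {z} {z'} d
  ≈D³-trans : ∀ {p q r} → (p ≈D³ q) → (q ≈D³ r) → (p ≈D³ r)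
  ≈D³-trans {x , y , z} {x' , y' , z'} {x'' , y'' , z''} (a , b , d) (a' , b' , d') =
    ≈D-trans {x} {x'} {x''} a a' , ≈D-trans {y} {y'} {y''} b b' , ≈D-trans {z} {z'} {z''} d d'

  module C₂ = FormalCombinations (Field.commutativeRing F) D² _≈D²_ _≈D²?_ (λ p → ≈D-refl (proj₁ p) , ≈D-refl (proj₂ p))
      (λ {p} {q} → ≈D²-sym {p} {q}) (λ {p} {q} {r} → ≈D²-trans {p} {q} {r})
  module C₃ = FormalCombinations (Field.commutativeRing F) D³ _≈D³_ _≈D³?_
      (λ p → ≈D-refl (proj₁ p) , ≈D-refl (proj₁ (proj₂ p)) , ≈D-refl (proj₂ (proj₂ p))) (λ {p} {q} → ≈D³-sym {p} {q})
          (λ {p} {q} {r} → ≈D³-trans {p} {q} {r})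

  coeff₂≡coeff : ∀ s a b → coeff₂ s a b Eq.≡ C₂.coeff s (a , b)
  coeff₂≡coeff [] a b = Eq.refl
  coeff₂≡coeff ((r , x , y) ∷ s) a b = Eq.cong (_ +_) (coeff₂≡coeff s a b)

  coeff₃≡coeff : ∀ s a b d → coeff₃ s a b d Eq.≡ C₃.coeff s (a , b , d)
  coeff₃≡coeff [] a b d = Eq.refl
  coeff₃≡coeff ((r , x , y , z) ∷ s) a b d = Eq.cong (_ +_) (coeff₃≡coeff s a b d)

  ≈₂⇒≋ : ∀ {s t} → s ≈₂ t → s C₂.≋ t
  ≈₂⇒≋ {s} {t} e (a , b) = Eq.subst₂ _≈_ (coeff₂≡coeff s a b) (coeff₂≡coeff t a b) (e a b)

  ≋⇒≈₂ : ∀ {s t} → s C₂.≋ t → s ≈₂ t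
  ≋⇒≈₂ {s} {t} e a b = Eq.subst₂ _≈_ (Eq.sym (coeff₂≡coeff s a b)) (Eq.sym (coeff₂≡coeff t a b)) (e (a , b))

  ≈₃⇒≋ : ∀ {s t} → s ≈₃ t → s C₃.≋ t
  ≈₃⇒≋ {s} {t} e (a , b , d) = Eq.subst₂ _≈_ (coeff₃≡coeff s a b d) (coeff₃≡coeff t a b d) (e a b d)

  ≋⇒≈₃ : ∀ {s t} → s C₃.≋ t → s ≈₃ t
  ≋⇒≈₃ {s} {t} e a b d = Eq.subst₂ _≈_ (Eq.sym (coeff₃≡coeff s a b d)) (Eq.sym (coeff₃≡coeff t a b d)) (e (a , b , d))

  ≈₂-trans : ∀ {s t u} → s ≈₂ t → t ≈₂ u → s ≈₂ u
  ≈₂-trans e e' a b = trans (e a b) (e' a b)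
  ≈₂-sym : ∀ {s t} → s ≈₂ t → t ≈₂ s
  ≈₂-sym e a b = sym (e a b)
  ≈₂-refl : ∀ {s} → s ≈₂ s
  ≈₂-refl a b = refl

  ≈₃-trans : ∀ {s t u} → s ≈₃ t → t ≈₃ u → s ≈₃ u
  ≈₃-trans e e' a b d = trans (e a b d) (e' a b d)

  ≈₃-sym : ∀ {s t} → s ≈₃ t → t ≈₃ s
  ≈₃-sym e a b d = sym (e a b d)

  ≈₂-setoid : Setoid c ℓ
  ≈₂-setoid = record { _≈_ = _≈₂_ ; isEquivalence = record
    { refl = λ {s} → ≈₂-refl {s} ; sym = λ {s} {t} → ≈₂-sym {s} {t} ; trans = λ {s} {t} {u} → ≈₂-trans {s} {t} {u} } }

  ≈₃-setoid : Setoid c ℓ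
  ≈₃-setoid = record { _≈_ = _≈₃_ ; isEquivalence = record
    { refl = λ _ _ _ → refl ; sym = λ {s} {t} → ≈₃-sym {s} {t} ; trans = λ {s} {t} {u} → ≈₃-trans {s} {t} {u} } }

  module ≈₂-Reasoning = Relation.Binary.Reasoning.Setoid ≈₂-setoid
  module ≈₃-Reasoning = Relation.Binary.Reasoning.Setoid ≈₃-setoid

  _≈Dᵇ_ : Diagram → Diagram → Bool
  x ≈Dᵇ a = does (x ≈D? a)

  infix 4 _≈D²_ _≈D²?_ _≈D³_ _≈D³?_ _≈Dᵇ_ _≈D³ᵇ_

  χ-∧-*ʳ : ∀ p q y r r' → χ (p ∧ q ∧ y) (r * r') ≈ r * χ y (χ (p ∧ q) r')
  χ-∧-*ʳ true true true r r' = refl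
  χ-∧-*ʳ true true false r r' = sym (zeroʳ r)
  χ-∧-*ʳ true false y r r' = sym (trans (*-cong refl (χ-0# y)) (zeroʳ r))
  χ-∧-*ʳ false q y r r' = sym (trans (*-cong refl (χ-0# y)) (zeroʳ r))

  χ-∧-*ˡ : ∀ p q y r r' → χ (p ∧ q ∧ y) (r * r') ≈ r * χ p (χ (q ∧ y) r')
  χ-∧-*ˡ true q y r r' = χ-* (q ∧ y) r r'
  χ-∧-*ˡ false q y r r' = sym (zeroʳ r)

  module TensorFormulas (Δ : Diagram → ParSym⊗²) where

    ⊗id-coeff id⊗-coeff : Diagram → Diagram → Diagram → D² → Carrier
    ⊗id-coeff a b d (x , y) = χ (y ≈Dᵇ d) (C₂.coeff (Δ x) (a , b))
    id⊗-coeff a b d (x , y) = χ (x ≈Dᵇ a) (C₂.coeff (Δ y) (b , d))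

    coeff-⊗id : ∀ u a b d → C₃.coeff ((Δ ⊗id) u) (a , b , d) ≈ C₂.eval (⊗id-coeff a b d) u
    coeff-⊗id u a b d = trans (∑-concatMap _ u _) (∑-cong u λ { (r , x , y) →
                   trans (≡⇒≈ (∑-map _ (Δ x) _))
                     (trans (∑-cong (Δ x) (λ { (r' , p , q) → χ-∧-*ʳ (p ≈Dᵇ a) (q ≈Dᵇ b) (y ≈Dᵇ d) r r' }))
                       (trans (∑-* (Δ x) r _) (*-cong refl (sym (χ-∑ (y ≈Dᵇ d) (Δ x) _))))) })

    coeff-id⊗ : ∀ u a b d → C₃.coeff ((id⊗ Δ) u) (a , b , d) ≈ C₂.eval (id⊗-coeff a b d) u
    coeff-id⊗ u a b d = trans (∑-concatMap _ u _) (∑-cong u λ { (r , x , y) →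
                   trans (≡⇒≈ (∑-map _ (Δ y) _))
                     (trans (∑-cong (Δ y) (λ { (r' , p , q) → χ-∧-*ˡ (x ≈Dᵇ a) (p ≈Dᵇ b) (q ≈Dᵇ d) r r' }))
                       (trans (∑-* (Δ y) r _) (*-cong refl (sym (χ-∑ (x ≈Dᵇ a) (Δ y) _))))) })

  ≈Dᵇ-respˡ : ∀ {x x'} a → x ≈D x' → (x ≈Dᵇ a) Eq.≡ (x' ≈Dᵇ a)
  ≈Dᵇ-respˡ {x} {x'} a e = does-⇔ (mk⇔ (≈D-trans {x'} {x} {a} (≈D-sym {x} {x'} e)) (≈D-trans {x} {x'} {a} e)) (x ≈D? a) (x' ≈D? a)

  _·₃_ : ParSym⊗³ → ParSym⊗³ → ParSym⊗³
  S ·₃ T = concatMap (λ { (r , x , y , z) → map (λ { (r' , x' , y' , z') → (r * r' , x ⊗ x' , y ⊗ y' , z ⊗ z') }) T }) S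

  ∑-·₂ : ∀ s t (g : Carrier × D² → Carrier) → ∑ (s ·₂ t) g ≈
        ∑ s (λ e → ∑ t (λ e' → g (proj₁ e * proj₁ e' , proj₁ (proj₂ e) ⊗ proj₁ (proj₂ e') , proj₂ (proj₂ e) ⊗ proj₂ (proj₂ e'))))
  ∑-·₂ s t g = trans (∑-concatMap _ s g) (∑-cong s λ { (r , x , y) → ≡⇒≈ (∑-map _ t g) })

  ∑-·₃ : ∀ S T (g : Carrier × D³ → Carrier) → ∑ (S ·₃ T) g ≈
        ∑ S (λ e → ∑ T (λ e' → g (proj₁ e * proj₁ e' , proj₁ (proj₂ e) ⊗ proj₁ (proj₂ e') ,
               proj₁ (proj₂ (proj₂ e)) ⊗ proj₁ (proj₂ (proj₂ e')) , proj₂ (proj₂ (proj₂ e)) ⊗ proj₂ (proj₂ (proj₂ e')))))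
  ∑-·₃ S T g = trans (∑-concatMap _ S g) (∑-cong S λ { (r , x , y , z) → ≡⇒≈ (∑-map _ T g) })

  _≈D³ᵇ_ : D³ → D³ → Bool
  E ≈D³ᵇ c = does (E ≈D³? c)

  _⊗₃_ : D³ → D³ → D³
  (x , y , z) ⊗₃ (x' , y' , z') = x ⊗ x' , y ⊗ y' , z ⊗ z'

  ≈D³ᵇ-⊗-congˡ : ∀ {E E₀} E' c → (E ≈D³ E₀) → ((E ⊗₃ E') ≈D³ᵇ c) Eq.≡ ((E₀ ⊗₃ E') ≈D³ᵇ c)
  ≈D³ᵇ-⊗-congˡ {x , y , z} {x₀ , y₀ , z₀} (x' , y' , z') (a , b , d) (e1 , e2 , e3) =
    Eq.cong₂ _∧_ (≈Dᵇ-respˡ {x ⊗ x'} {x₀ ⊗ x'} a (⊗-cong {x} {x₀} {x'} {x'} e1 (≈D-refl x')))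
      (Eq.cong₂ _∧_ (≈Dᵇ-respˡ {y ⊗ y'} {y₀ ⊗ y'} b (⊗-cong {y} {y₀} {y'} {y'} e2 (≈D-refl y')))
                   (≈Dᵇ-respˡ {z ⊗ z'} {z₀ ⊗ z'} d (⊗-cong {z} {z₀} {z'} {z'} e3 (≈D-refl z'))))

  ≈D³ᵇ-⊗-congʳ : ∀ {E' E₀} E c → (E' ≈D³ E₀) → ((E ⊗₃ E') ≈D³ᵇ c) Eq.≡ ((E ⊗₃ E₀) ≈D³ᵇ c)
  ≈D³ᵇ-⊗-congʳ {x' , y' , z'} {x₀ , y₀ , z₀} (x , y , z) (a , b , d) (e1 , e2 , e3) =
    Eq.cong₂ _∧_ (≈Dᵇ-respˡ {x ⊗ x'} {x ⊗ x₀} a (⊗-cong {x} {x} {x'} {x₀} (≈D-refl x) e1))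
      (Eq.cong₂ _∧_ (≈Dᵇ-respˡ {y ⊗ y'} {y ⊗ y₀} b (⊗-cong {y} {y} {y'} {y₀} (≈D-refl y) e2))
                   (≈Dᵇ-respˡ {z ⊗ z'} {z ⊗ z₀} d (⊗-cong {z} {z} {z'} {z₀} (≈D-refl z) e3)))

  coeff-·₃ : ∀ S T c → C₃.coeff (S ·₃ T) c ≈ ∑ S (λ e → ∑ T (λ e' → χ (proj₂ e ⊗₃ proj₂ e' ≈D³ᵇ c) (proj₁ e * proj₁ e')))
  coeff-·₃ S T c = trans (∑-·₃ S T _) (∑-cong S λ { (r , x , y , z) → ∑-cong T λ { (r' , x' , y' , z') → refl } })

  ·₃-congˡ : ∀ {S S'} T → S ≈₃ S' → (S ·₃ T) ≈₃ (S' ·₃ T)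
  ·₃-congˡ {S} {S'} T e = ≋⇒≈₃ {S ·₃ T} {S' ·₃ T} λ c → trans (coeff-·₃ S T c) (trans (as-eval S c)
     (trans (C₃.eval-cong (weight c) (λ {E} {E₀} r → ∑-cong T λ e' → ≡⇒≈ (Eq.cong (λ b → χ b (proj₁ e')) (≈D³ᵇ-⊗-congˡ {E} {E₀} (proj₂ e') c r))) {S} {S'}
             (≈₃⇒≋ {S} {S'} e))
       (sym (trans (coeff-·₃ S' T c) (as-eval S' c)))))
    where
    weight : D³ → D³ → Carrier
    weight c E = ∑ T (λ e' → χ (E ⊗₃ proj₂ e' ≈D³ᵇ c) (proj₁ e'))
    as-eval : ∀ U c → ∑ U (λ e → ∑ T (λ e' → χ (proj₂ e ⊗₃ proj₂ e' ≈D³ᵇ c) (proj₁ e * proj₁ e'))) ≈ C₃.eval (weight c) U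
    as-eval U c = ∑-cong U λ e → trans (∑-cong T (λ e' → χ-* (proj₂ e ⊗₃ proj₂ e' ≈D³ᵇ c) (proj₁ e) (proj₁ e'))) (∑-* T (proj₁ e) _)

  ·₃-congʳ : ∀ S {T T'} → T ≈₃ T' → (S ·₃ T) ≈₃ (S ·₃ T')
  ·₃-congʳ S {T} {T'} e = ≋⇒≈₃ {S ·₃ T} {S ·₃ T'} λ c → trans (coeff-·₃ S T c) (trans (as-eval T c)
     (trans (C₃.eval-cong (weight c) (λ {E'} {E₀} r → ∑-cong S λ e → ≡⇒≈ (Eq.cong (λ b → χ b (proj₁ e)) (≈D³ᵇ-⊗-congʳ {E'} {E₀} (proj₂ e) c r))) {T} {T'}
             (≈₃⇒≋ {T} {T'} e))
       (sym (trans (coeff-·₃ S T' c) (as-eval T' c)))))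
    where
    weight : D³ → D³ → Carrier
    weight c E' = ∑ S (λ e → χ (proj₂ e ⊗₃ E' ≈D³ᵇ c) (proj₁ e))
    as-eval : ∀ U c → ∑ S (λ e → ∑ U (λ e' → χ (proj₂ e ⊗₃ proj₂ e' ≈D³ᵇ c) (proj₁ e * proj₁ e'))) ≈ C₃.eval (weight c) U
    as-eval U c = trans (∑-swap S U _) (∑-cong U λ e' → trans (∑-cong S (λ e → trans (χ-cong (proj₂ e ⊗₃ proj₂ e' ≈D³ᵇ c) (*-comm _ _))
                (χ-* (proj₂ e ⊗₃ proj₂ e' ≈D³ᵇ c) (proj₁ e') (proj₁ e)))) (∑-* S (proj₁ e') _))

  _≈D²ᵇ_ : D² → D² → Bool
  p ≈D²ᵇ q = does (p ≈D²? q)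

  infix 4 _≈D²ᵇ_

  _⊗₂_ : D² → D² → D²
  (x , y) ⊗₂ (x' , y') = x ⊗ x' , y ⊗ y'

  coeff-·₂ : ∀ s t q → C₂.coeff (s ·₂ t) q ≈ ∑ s (λ e → ∑ t (λ e' → χ (proj₂ e ⊗₂ proj₂ e' ≈D²ᵇ q) (proj₁ e * proj₁ e')))
  coeff-·₂ s t q = trans (∑-·₂ s t _) (∑-cong s λ { (r , x , y) → ∑-cong t λ { (r' , x' , y') → refl } })

  ≈D²ᵇ-⊗-congˡ : ∀ {E E₀} E' q → (E ≈D² E₀) → ((E ⊗₂ E') ≈D²ᵇ q) Eq.≡ ((E₀ ⊗₂ E') ≈D²ᵇ q)
  ≈D²ᵇ-⊗-congˡ {x , y} {x₀ , y₀} (x' , y') (a , b) (e1 , e2) =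
    Eq.cong₂ _∧_ (≈Dᵇ-respˡ {x ⊗ x'} {x₀ ⊗ x'} a (⊗-cong {x} {x₀} {x'} {x'} e1 (≈D-refl x')))
                (≈Dᵇ-respˡ {y ⊗ y'} {y₀ ⊗ y'} b (⊗-cong {y} {y₀} {y'} {y'} e2 (≈D-refl y')))

  ≈D²ᵇ-⊗-congʳ : ∀ {E' E₀} E q → (E' ≈D² E₀) → ((E ⊗₂ E') ≈D²ᵇ q) Eq.≡ ((E ⊗₂ E₀) ≈D²ᵇ q)
  ≈D²ᵇ-⊗-congʳ {x' , y'} {x₀ , y₀} (x , y) (a , b) (e1 , e2) =
    Eq.cong₂ _∧_ (≈Dᵇ-respˡ {x ⊗ x'} {x ⊗ x₀} a (⊗-cong {x} {x} {x'} {x₀} (≈D-refl x) e1))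
                (≈Dᵇ-respˡ {y ⊗ y'} {y ⊗ y₀} b (⊗-cong {y} {y} {y'} {y₀} (≈D-refl y) e2))

  ·₂-congˡ : ∀ {S S'} T → S ≈₂ S' → (S ·₂ T) ≈₂ (S' ·₂ T)
  ·₂-congˡ {S} {S'} T e = ≋⇒≈₂ {S ·₂ T} {S' ·₂ T} λ q → trans (coeff-·₂ S T q) (trans (as-eval S q)
     (trans (C₂.eval-cong (weight q) (λ {E} {E₀} r → ∑-cong T λ e' → ≡⇒≈ (Eq.cong (λ b → χ b (proj₁ e')) (≈D²ᵇ-⊗-congˡ {E} {E₀} (proj₂ e') q r))) {S} {S'}
             (≈₂⇒≋ {S} {S'} e))
       (sym (trans (coeff-·₂ S' T q) (as-eval S' q)))))
    where
    weight : D² → D² → Carrier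
    weight q E = ∑ T (λ e' → χ (E ⊗₂ proj₂ e' ≈D²ᵇ q) (proj₁ e'))
    as-eval : ∀ U q → ∑ U (λ e → ∑ T (λ e' → χ (proj₂ e ⊗₂ proj₂ e' ≈D²ᵇ q) (proj₁ e * proj₁ e'))) ≈ C₂.eval (weight q) U
    as-eval U q = ∑-cong U λ e → trans (∑-cong T (λ e' → χ-* (proj₂ e ⊗₂ proj₂ e' ≈D²ᵇ q) (proj₁ e) (proj₁ e'))) (∑-* T (proj₁ e) _)

  ·₂-congʳ : ∀ S {T T'} → T ≈₂ T' → (S ·₂ T) ≈₂ (S ·₂ T')
  ·₂-congʳ S {T} {T'} e = ≋⇒≈₂ {S ·₂ T} {S ·₂ T'} λ q → trans (coeff-·₂ S T q) (trans (as-eval T q)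
     (trans (C₂.eval-cong (weight q) (λ {E'} {E₀} r → ∑-cong S λ e → ≡⇒≈ (Eq.cong (λ b → χ b (proj₁ e)) (≈D²ᵇ-⊗-congʳ {E'} {E₀} (proj₂ e) q r))) {T} {T'}
             (≈₂⇒≋ {T} {T'} e))
       (sym (trans (coeff-·₂ S T' q) (as-eval T' q)))))
    where
    weight : D² → D² → Carrier
    weight q E' = ∑ S (λ e → χ (proj₂ e ⊗₂ E' ≈D²ᵇ q) (proj₁ e))
    as-eval : ∀ U q → ∑ S (λ e → ∑ U (λ e' → χ (proj₂ e ⊗₂ proj₂ e' ≈D²ᵇ q) (proj₁ e * proj₁ e'))) ≈ C₂.eval (weight q) U
    as-eval U q = trans (∑-swap S U _) (∑-cong U λ e' → trans (∑-cong S (λ e → trans (χ-cong (proj₂ e ⊗₂ proj₂ e' ≈D²ᵇ q) (*-comm _ _))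
                (χ-* (proj₂ e ⊗₂ proj₂ e' ≈D²ᵇ q) (proj₁ e') (proj₁ e)))) (∑-* S (proj₁ e') _))

  ·₂-assoc : ∀ s t u → ((s ·₂ t) ·₂ u) ≈₂ (s ·₂ (t ·₂ u))
  ·₂-assoc s t u = ≋⇒≈₂ {(s ·₂ t) ·₂ u} {s ·₂ (t ·₂ u)} λ { (a , b) →
    trans (coeff-·₂ (s ·₂ t) u (a , b)) (trans (∑-·₂ s t _) (trans (∑-cong s λ { (r , x , y) → ∑-cong t λ { (r' , x' , y') →
      ∑-cong u λ { (r'' , x'' , y'') → trans (≡⇒≈ (Eq.cong₂ (λ b1 b2 → χ (b1 ∧ b2) ((r * r') * r''))
          (≈Dᵇ-respˡ {(x ⊗ x') ⊗ x''} {x ⊗ (x' ⊗ x'')} a (⊗-assoc x x' x''))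
          (≈Dᵇ-respˡ {(y ⊗ y') ⊗ y''} {y ⊗ (y' ⊗ y'')} b (⊗-assoc y y' y''))))
        (χ-cong _ (*-assoc r r' r'')) } } })
      (sym (trans (coeff-·₂ s (t ·₂ u) (a , b)) (∑-cong s λ e → ∑-·₂ t u _))))) }

  ·₂-identityˡ : ∀ s → (one₂ ·₂ s) ≈₂ s
  ·₂-identityˡ s = ≋⇒≈₂ {one₂ ·₂ s} {s} λ { (a , b) → trans (coeff-·₂ one₂ s (a , b)) (trans (+-identityʳ _)
    (∑-cong s λ { (r , x , y) → trans (≡⇒≈ (Eq.cong₂ (λ b1 b2 → χ (b1 ∧ b2) (1# * r))
        (≈Dᵇ-respˡ {∅ ⊗ x} {x} a (⊗-identityˡ ∅ x Eq.refl)) (≈Dᵇ-respˡ {∅ ⊗ y} {y} b (⊗-identityˡ ∅ y Eq.refl))))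
      (χ-cong _ (*-identityˡ r)) })) }

  ·₂-identityʳ : ∀ s → (s ·₂ one₂) ≈₂ s
  ·₂-identityʳ s = ≋⇒≈₂ {s ·₂ one₂} {s} λ { (a , b) → trans (coeff-·₂ s one₂ (a , b))
    (∑-cong s λ { (r , x , y) → trans (+-identityʳ _) (trans (≡⇒≈ (Eq.cong₂ (λ b1 b2 → χ (b1 ∧ b2) (r * 1#))
        (≈Dᵇ-respˡ {x ⊗ ∅} {x} a (⊗-identityʳ x ∅ Eq.refl)) (≈Dᵇ-respˡ {y ⊗ ∅} {y} b (⊗-identityʳ y ∅ Eq.refl))))
      (χ-cong _ (*-identityʳ r))) }) }

  product₂ : List ParSym⊗² → ParSym⊗²
  product₂ [] = one₂
  product₂ (x ∷ xs) = x ·₂ product₂ xs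

  product₂-++ : ∀ A B → product₂ (A ++ B) ≈₂ (product₂ A ·₂ product₂ B)
  product₂-++ [] B = ≈₂-sym {one₂ ·₂ product₂ B} {product₂ B} (·₂-identityˡ (product₂ B))
  product₂-++ (x ∷ A) B = begin
    x ·₂ product₂ (A ++ B)               ≈⟨ ·₂-congʳ x {product₂ (A ++ B)} {product₂ A ·₂ product₂ B} (product₂-++ A B) ⟩
    x ·₂ (product₂ A ·₂ product₂ B)      ≈⟨ ·₂-assoc x (product₂ A) (product₂ B) ⟨
    (x ·₂ product₂ A) ·₂ product₂ B      ∎
    where open ≈₂-Reasoning

  product₂-cong : ∀ {A B} → Pointwise _≈₂_ A B → product₂ A ≈₂ product₂ B
  product₂-cong [] = ≈₂-refl {one₂}
  product₂-cong {x ∷ xs} {y ∷ ys} (x≈y ∷ xs≈ys) = begin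
    x ·₂ product₂ xs  ≈⟨ ·₂-congˡ {x} {y} (product₂ xs) x≈y ⟩
    y ·₂ product₂ xs  ≈⟨ ·₂-congʳ y {product₂ xs} {product₂ ys} (product₂-cong xs≈ys) ⟩
    y ·₂ product₂ ys  ∎
    where open ≈₂-Reasoning



module CutCoproduct {c ℓ} (F : Field c ℓ) where

  open import Data.Nat using (ℕ; suc; _≤_; _<_; s≤s) renaming (_+_ to _+ℕ_)
  open import Data.Nat.Properties using (m≤m+n; anyUpTo?)
  open import Data.Bool using (Bool; true; false; if_then_else_)
  open import Data.List using ([]; concatMap; length; [_]; take; drop; downFrom)
  open import Data.List.Properties using (take++drop≡id)
  open import Data.Product using (_×_; _,_; proj₁; proj₂)
  open import Relation.Nullary using (Dec; does)
  open import Relation.Nullary.Decidable using (_×-dec_)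
  import Relation.Binary.PropositionalEquality as Eq
  open ColumnForm
  open Occurrence
  open ColumnsOfProducts
  open ProductLaws
  open CutAssociativity
  open Tensors F

  cutTerm : Cols → ℕ → ParSym⊗²
  cutTerm cs j = if does (ValidCut? j cs) then [ (1# , fromCols (take j cs) , fromCols (drop j cs)) ] else []

  cutSum : Cols → ParSym⊗²
  cutSum cs = concatMap (cutTerm cs) (downFrom (suc (length cs)))

  ∑-if : ∀ {a} {X : Set a} (b : Bool) (x : X) g → ∑ (if b then [ x ] else []) g ≈ χ b (g x)
  ∑-if true x g = +-identityʳ _
  ∑-if false x g = refl

  CutMatches : Cols → Diagram → Diagram → ℕ → Set
  CutMatches cs a b j = ValidCut j cs × (fromCols (take j cs) ≈D a) × (fromCols (drop j cs) ≈D b)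

  CutMatches? : ∀ cs a b j → Dec (CutMatches cs a b j)
  CutMatches? cs a b j = ValidCut? j cs ×-dec (fromCols (take j cs) ≈D? a) ×-dec (fromCols (drop j cs) ≈D? b)

  coeff-cutSum : ∀ cs a b → C₂.coeff (cutSum cs) (a , b) ≈ count (CutMatches? cs a b) (suc (length cs))
  coeff-cutSum cs a b = trans (∑-concatMap (cutTerm cs) (downFrom (suc (length cs))) h) (∑-cong (downFrom (suc (length cs))) λ j →
    trans (∑-if (does (ValidCut? j cs)) (1# , fromCols (take j cs) , fromCols (drop j cs)) h)
          (χ-∧ (does (ValidCut? j cs)) (does ((fromCols (take j cs) ≈D? a) ×-dec (fromCols (drop j cs) ≈D? b))) 1#))
    where h : Carrier × D² → Carrier
          h e = χ (does (proj₂ e ≈D²? (a , b))) (proj₁ e)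

  CutMatches⇒CutPair : ∀ cs a b j → j < suc (length cs) → CutMatches cs a b j → CutPair cs a b × (j Eq.≡ ∣ a ∣)
  CutMatches⇒CutPair cs a b j jl ((gl , nT , nD) , ea , eb) with length-take< j cs jl | Relabel-length ra
    where ra = ≈D⇒Relabel-fromCols (take j cs) a ea
  ... | lt | lr with Eq.trans (Eq.sym lt) lr
  ... | Eq.refl = (NoSplit-Relabel ra nT , NoSplit-Relabel rb nD , lsum , gl , Relabel-sym ra , Relabel-sym rb) , Eq.refl
    where
    ra = ≈D⇒Relabel-fromCols (take j cs) a ea
    rb = ≈D⇒Relabel-fromCols (drop j cs) b eb
    lsum : ∣ a ∣ +ℕ ∣ b ∣ Eq.≡ length cs
    lsum = Eq.trans (Eq.cong₂ _+ℕ_ (Eq.sym (Relabel-length ra)) (Eq.sym (Relabel-length rb)))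
             (Eq.trans (Eq.sym (length-++ᶜ (take j cs) (drop j cs))) (Eq.cong length (take++drop≡id j cs)))

  CutPair⇒CutMatches : ∀ cs a b → CutPair cs a b → CutMatches cs a b ∣ a ∣ × (∣ a ∣ < suc (length cs))
  CutPair⇒CutMatches cs a b (na , nb , l , gl , ra , rb) =
    ((gl , NoSplit-Relabel ra na , NoSplit-Relabel rb nb) , Relabel⇒≈D-fromCols _ a (Relabel-sym ra) , Relabel⇒≈D-fromCols _ b (Relabel-sym rb)) ,
    s≤s (Eq.subst (∣ a ∣ ≤_) l (m≤m+n ∣ a ∣ ∣ b ∣))

  coeff-cutSum-χ : ∀ cs a b → C₂.coeff (cutSum cs) (a , b) ≈ χ (does (CutPair? cs a b)) 1#
  coeff-cutSum-χ cs a b = begin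
    C₂.coeff (cutSum cs) (a , b)                          ≈⟨ coeff-cutSum cs a b ⟩
    count (CutMatches? cs a b) N                          ≈⟨ count-anyUpTo? (CutMatches? cs a b) N unique ⟩
    χ (does (anyUpTo? (CutMatches? cs a b) N)) 1#         ≡⟨ Eq.cong (λ b → χ b 1#)
        (does-⇔ (mk⇔ to from) (anyUpTo? (CutMatches? cs a b) N) (CutPair? cs a b)) ⟩
    χ (does (CutPair? cs a b)) 1#                         ∎
    where
    open ≈-Reasoning
    N = suc (length cs)
    position : ∀ {j} → j < N → CutMatches cs a b j → j Eq.≡ ∣ a ∣
    position j<N m = proj₂ (CutMatches⇒CutPair cs a b _ j<N m)
    unique : ∀ {i j} → i < N → j < N → CutMatches cs a b i → CutMatches cs a b j → i Eq.≡ j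
    unique i<N j<N mi mj = Eq.trans (position i<N mi) (Eq.sym (position j<N mj))
    to : (Σ ℕ λ j → j < N × CutMatches cs a b j) → CutPair cs a b
    to (j , j<N , m) = proj₁ (CutMatches⇒CutPair cs a b j j<N m)
    from : CutPair cs a b → Σ ℕ λ j → j < N × CutMatches cs a b j
    from p = ∣ a ∣ , proj₂ (CutPair⇒CutMatches cs a b p) , proj₁ (CutPair⇒CutMatches cs a b p)

module Coassociativity {c ℓ} (F : Field c ℓ) (Δ : Diagram → ParSymOver.ParSym⊗² F)
    (isΔ : ParSymOver.IsCoproduct F Δ) where

  open import Data.Nat using (ℕ; zero; suc; _≤_; _<_; s≤s; _≟_) renaming (_+_ to _+ℕ_)
  open import Data.Nat.Properties using (≤-refl; ≤-trans; anyUpTo?; n≤0⇒n≡0; <⇒≤; ≤-pred)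
  open import Data.Bool using (true; false; _∧_)
  open import Data.List using (length; take; drop; downFrom)
  open import Data.Product using (Σ; _×_; _,_; proj₁; proj₂)
  open import Data.Sum using (inj₁; inj₂)
  open import Relation.Nullary using (Dec; yes; no; does)
  open import Relation.Nullary.Decidable using (_×-dec_)
  import Relation.Binary.PropositionalEquality as Eq
  open ColumnForm
  open Occurrence
  open ColumnsOfProducts
  open ProductLaws
  open CutAssociativity
  open Tensors F
  open CutCoproduct F
  open IsCoproduct isΔ
  open TensorFormulas Δ

  ⊗id-coeff-resp : ∀ a b d → C₂.Respects (⊗id-coeff a b d)
  ⊗id-coeff-resp a b d {x , y} {x' , y'} (x≈x' , y≈y') =
    trans (≡⇒≈ (Eq.cong (λ t → χ t (C₂.coeff (Δ x) (a , b))) (≈Dᵇ-respˡ {y} {y'} d y≈y')))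
          (χ-cong _ (≈₂⇒≋ {Δ x} {Δ x'} (wellDefined x x' x≈x') (a , b)))

  id⊗-coeff-resp : ∀ a b d → C₂.Respects (id⊗-coeff a b d)
  id⊗-coeff-resp a b d {x , y} {x' , y'} (x≈x' , y≈y') =
    trans (≡⇒≈ (Eq.cong (λ t → χ t (C₂.coeff (Δ y) (b , d))) (≈Dᵇ-respˡ {x} {x'} a x≈x')))
          (χ-cong _ (≈₂⇒≋ {Δ y} {Δ y'} (wellDefined y y' y≈y') (b , d)))

  ⊗id-cong : ∀ s t → s ≈₂ t → (Δ ⊗id) s ≈₃ (Δ ⊗id) t
  ⊗id-cong s t s≈t = ≋⇒≈₃ {(Δ ⊗id) s} {(Δ ⊗id) t} λ { (a , b , d) → begin
    C₃.coeff ((Δ ⊗id) s) (a , b , d)  ≈⟨ coeff-⊗id s a b d ⟩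
    C₂.eval (⊗id-coeff a b d) s       ≈⟨ C₂.eval-cong _ (λ {p} {q} → ⊗id-coeff-resp a b d {p} {q}) {s} {t} (≈₂⇒≋ {s} {t} s≈t) ⟩
    C₂.eval (⊗id-coeff a b d) t       ≈⟨ coeff-⊗id t a b d ⟨
    C₃.coeff ((Δ ⊗id) t) (a , b , d)  ∎ }
    where open ≈-Reasoning

  id⊗-cong : ∀ s t → s ≈₂ t → (id⊗ Δ) s ≈₃ (id⊗ Δ) t
  id⊗-cong s t s≈t = ≋⇒≈₃ {(id⊗ Δ) s} {(id⊗ Δ) t} λ { (a , b , d) → begin
    C₃.coeff ((id⊗ Δ) s) (a , b , d)  ≈⟨ coeff-id⊗ s a b d ⟩
    C₂.eval (id⊗-coeff a b d) s       ≈⟨ C₂.eval-cong _ (λ {p} {q} → id⊗-coeff-resp a b d {p} {q}) {s} {t} (≈₂⇒≋ {s} {t} s≈t) ⟩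
    C₂.eval (id⊗-coeff a b d) t       ≈⟨ coeff-id⊗ t a b d ⟨
    C₃.coeff ((id⊗ Δ) t) (a , b , d)  ∎ }
    where open ≈-Reasoning

  ∑-⊗id : ∀ u (g : Carrier × D³ → Carrier) → ∑ ((Δ ⊗id) u) g ≈
    ∑ u (λ e → ∑ (Δ (proj₁ (proj₂ e))) (λ f → g (proj₁ e * proj₁ f , proj₁ (proj₂ f) , proj₂ (proj₂ f) , proj₂ (proj₂ e))))
  ∑-⊗id u g = trans (∑-concatMap _ u g) (∑-cong u λ { (r , x , y) → ≡⇒≈ (∑-map _ (Δ x) g) })

  ∑-id⊗ : ∀ u (g : Carrier × D³ → Carrier) → ∑ ((id⊗ Δ) u) g ≈
    ∑ u (λ e → ∑ (Δ (proj₂ (proj₂ e))) (λ f → g (proj₁ e * proj₁ f , proj₁ (proj₂ e) , proj₁ (proj₂ f) , proj₂ (proj₂ f))))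
  ∑-id⊗ u g = trans (∑-concatMap _ u g) (∑-cong u λ { (r , x , y) → ≡⇒≈ (∑-map _ (Δ y) g) })

  ⊗id-·₂ : ∀ s t → (Δ ⊗id) (s ·₂ t) ≈₃ ((Δ ⊗id) s ·₃ (Δ ⊗id) t)
  ⊗id-·₂ s t = ≋⇒≈₃ {(Δ ⊗id) (s ·₂ t)} {(Δ ⊗id) s ·₃ (Δ ⊗id) t} λ { (a , b , d) → trans (lhs a b d) (sym (rhs a b d)) }
    where
    X : Diagram → Diagram → Diagram → Carrier × D² → Carrier × D² → Carrier × D² → Carrier × D² → Carrier
    X a b d (r , x , y) (r' , x' , y') (ρ , p , q) (ρ' , p' , q') =
      χ ((p ⊗ p' ≈Dᵇ a) ∧ (q ⊗ q' ≈Dᵇ b) ∧ (y ⊗ y' ≈Dᵇ d)) ((r * ρ) * (r' * ρ'))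
    lhs : ∀ a b d → C₃.coeff ((Δ ⊗id) (s ·₂ t)) (a , b , d) ≈
          ∑ s (λ e → ∑ t (λ e' → ∑ (Δ (proj₁ (proj₂ e))) (λ f → ∑ (Δ (proj₁ (proj₂ e'))) (λ f' → X a b d e e' f f'))))
    lhs a b d = trans (coeff-⊗id (s ·₂ t) a b d) (trans (∑-·₂ s t _) (∑-cong s λ { (r , x , y) → ∑-cong t λ { (r' , x' , y') →
      trans (*-cong refl (χ-cong (y ⊗ y' ≈Dᵇ d) (trans (≈₂⇒≋ {Δ (x ⊗ x')} {Δ x ·₂ Δ x'} (multiplicative x x') (a , b)) (∑-·₂ (Δ x) (Δ x') _))))
      (trans (*-cong refl (χ-∑ (y ⊗ y' ≈Dᵇ d) (Δ x) _))
      (trans (sym (∑-* (Δ x) _ _))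
      (∑-cong (Δ x) λ { (ρ , p , q) →
        trans (*-cong refl (χ-∑ (y ⊗ y' ≈Dᵇ d) (Δ x') _))
        (trans (sym (∑-* (Δ x') _ _))
        (∑-cong (Δ x') λ { (ρ' , p' , q') →
          trans (sym (χ-∧-*ʳ (p ⊗ p' ≈Dᵇ a) (q ⊗ q' ≈Dᵇ b) (y ⊗ y' ≈Dᵇ d) (r * r') (ρ * ρ')))
                (χ-cong ((p ⊗ p' ≈Dᵇ a) ∧ (q ⊗ q' ≈Dᵇ b) ∧ (y ⊗ y' ≈Dᵇ d)) (*-interchange r r' ρ ρ')) })) }))) } }))
    rhs : ∀ a b d → C₃.coeff ((Δ ⊗id) s ·₃ (Δ ⊗id) t) (a , b , d) ≈
          ∑ s (λ e → ∑ t (λ e' → ∑ (Δ (proj₁ (proj₂ e))) (λ f → ∑ (Δ (proj₁ (proj₂ e'))) (λ f' → X a b d e e' f f'))))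
    rhs a b d = trans (coeff-·₃ ((Δ ⊗id) s) ((Δ ⊗id) t) (a , b , d)) (trans (∑-⊗id s _) (∑-cong s λ { (r , x , y) →
      trans (∑-cong (Δ x) (λ { (ρ , p , q) → trans (∑-⊗id t _) (∑-cong t λ { (r' , x' , y') → ∑-cong (Δ x') λ { (ρ' , p' , q') → refl } }) }))
            (∑-swap (Δ x) t _) }))

  id⊗-·₂ : ∀ s t → (id⊗ Δ) (s ·₂ t) ≈₃ ((id⊗ Δ) s ·₃ (id⊗ Δ) t)
  id⊗-·₂ s t = ≋⇒≈₃ {(id⊗ Δ) (s ·₂ t)} {(id⊗ Δ) s ·₃ (id⊗ Δ) t} λ { (a , b , d) → trans (lhs a b d) (sym (rhs a b d)) }
    where
    X : Diagram → Diagram → Diagram → Carrier × D² → Carrier × D² → Carrier × D² → Carrier × D² → Carrier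
    X a b d (r , x , y) (r' , x' , y') (ρ , p , q) (ρ' , p' , q') =
      χ ((x ⊗ x' ≈Dᵇ a) ∧ (p ⊗ p' ≈Dᵇ b) ∧ (q ⊗ q' ≈Dᵇ d)) ((r * ρ) * (r' * ρ'))
    lhs : ∀ a b d → C₃.coeff ((id⊗ Δ) (s ·₂ t)) (a , b , d) ≈
          ∑ s (λ e → ∑ t (λ e' → ∑ (Δ (proj₂ (proj₂ e))) (λ f → ∑ (Δ (proj₂ (proj₂ e'))) (λ f' → X a b d e e' f f'))))
    lhs a b d = trans (coeff-id⊗ (s ·₂ t) a b d) (trans (∑-·₂ s t _) (∑-cong s λ { (r , x , y) → ∑-cong t λ { (r' , x' , y') →
      trans (*-cong refl (χ-cong (x ⊗ x' ≈Dᵇ a) (trans (≈₂⇒≋ {Δ (y ⊗ y')} {Δ y ·₂ Δ y'} (multiplicative y y') (b , d)) (∑-·₂ (Δ y) (Δ y') _))))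
      (trans (*-cong refl (χ-∑ (x ⊗ x' ≈Dᵇ a) (Δ y) _))
      (trans (sym (∑-* (Δ y) _ _))
      (∑-cong (Δ y) λ { (ρ , p , q) →
        trans (*-cong refl (χ-∑ (x ⊗ x' ≈Dᵇ a) (Δ y') _))
        (trans (sym (∑-* (Δ y') _ _))
        (∑-cong (Δ y') λ { (ρ' , p' , q') →
          trans (sym (χ-∧-*ˡ (x ⊗ x' ≈Dᵇ a) (p ⊗ p' ≈Dᵇ b) (q ⊗ q' ≈Dᵇ d) (r * r') (ρ * ρ')))
                (χ-cong ((x ⊗ x' ≈Dᵇ a) ∧ (p ⊗ p' ≈Dᵇ b) ∧ (q ⊗ q' ≈Dᵇ d)) (*-interchange r r' ρ ρ')) })) }))) } }))
    rhs : ∀ a b d → C₃.coeff ((id⊗ Δ) s ·₃ (id⊗ Δ) t) (a , b , d) ≈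
          ∑ s (λ e → ∑ t (λ e' → ∑ (Δ (proj₂ (proj₂ e))) (λ f → ∑ (Δ (proj₂ (proj₂ e'))) (λ f' → X a b d e e' f f'))))
    rhs a b d = trans (coeff-·₃ ((id⊗ Δ) s) ((id⊗ Δ) t) (a , b , d)) (trans (∑-id⊗ s _) (∑-cong s λ { (r , x , y) →
      trans (∑-cong (Δ y) (λ { (ρ , p , q) → trans (∑-id⊗ t _) (∑-cong t λ { (r' , x' , y') → ∑-cong (Δ y') λ { (ρ' , p' , q') → refl } }) }))
            (∑-swap (Δ y) t _) }))

  Δ-empty : ∀ π → IsEmpty π → Δ π ≈₂ one₂
  Δ-empty π ex = ≈₂-trans {Δ π} {Δ ∅} {one₂} (wellDefined π ∅ (IsEmpty-≈D π ∅ ex Eq.refl)) unit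

  coeff-Δ-generator : ∀ x → EmptyOrIrred x → ∀ a b → C₂.coeff (Δ x) (a , b) ≈ χ (does (GenPair? x a b)) 1#
  coeff-Δ-generator x (inj₂ irr) a b with order x ≟ 0
  ... | yes e = coeff-Δ-generator x (inj₁ e) a b
  ... | no ne = by-decision (GenPair? x a b)
    where
    og = onGenerators x ne irr a b
    by-decision : (d : Dec (GenPair x a b)) → C₂.coeff (Δ x) (a , b) ≈ χ (does d) 1#
    by-decision (yes g) = Eq.subst (_≈ 1#) (coeff₂≡coeff (Δ x) a b) (proj₁ og g)
    by-decision (no ng) = Eq.subst (_≈ 0#) (coeff₂≡coeff (Δ x) a b) (proj₂ og ng)
  coeff-Δ-generator x (inj₁ ex) a b =
    trans (≈₂⇒≋ {Δ x} {one₂} (Δ-empty x ex) (a , b))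
      (trans (+-identityʳ _) (≡⇒≈ (Eq.cong (λ bb → χ bb 1#)
        (does-⇔ (mk⇔ (GenPair-empty⇐ x a b ex) (GenPair-empty⇒ x a b ex)) ((∅ , ∅) ≈D²? (a , b)) (GenPair? x a b)))))

  Δ≈cutSum : ∀ π → NonEmpty π → Irred π → Δ π ≈₂ cutSum (cols π)
  Δ≈cutSum π ne irr = ≋⇒≈₂ {Δ π} {cutSum (cols π)} λ { (a , b) →
    trans (coeff-Δ-generator π (inj₂ irr) a b) (trans (≡⇒≈ (Eq.cong (λ bb → χ bb 1#)
      (does-⇔ (mk⇔ (GenPair⇒CutPair π a b) (CutPair⇒GenPair π a b)) (GenPair? π a b) (CutPair? (cols π) a b)))) (sym (coeff-cutSum-χ (cols π) a b))) }

  χ-∅-swap : ∀ A B D → χ D (χ (A ∧ B) 1# + 0#) ≈ χ A (χ (B ∧ D) 1# + 0#)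
  χ-∅-swap false B true = +-identityʳ _
  χ-∅-swap false B false = refl
  χ-∅-swap true false true = refl
  χ-∅-swap true false false = sym (+-identityʳ _)
  χ-∅-swap true true true = refl
  χ-∅-swap true true false = sym (+-identityʳ _)

  coassoc-one : (Δ ⊗id) one₂ ≈₃ (id⊗ Δ) one₂
  coassoc-one = ≋⇒≈₃ {(Δ ⊗id) one₂} {(id⊗ Δ) one₂} λ { (a , b , d) →
    trans (coeff-⊗id one₂ a b d) (trans (+-cong (*-cong refl
      (trans (χ-cong (∅ ≈Dᵇ d) (Δ∅ a b)) (trans (χ-∅-swap (∅ ≈Dᵇ a) (∅ ≈Dᵇ b) (∅ ≈Dᵇ d)) (χ-cong (∅ ≈Dᵇ a) (sym (Δ∅ b d)))))) refl)
      (sym (coeff-id⊗ one₂ a b d))) }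
    where
    Δ∅ : ∀ a b → C₂.coeff (Δ ∅) (a , b) ≈ χ ((∅ ≈Dᵇ a) ∧ (∅ ≈Dᵇ b)) 1# + 0#
    Δ∅ a b = ≈₂⇒≋ {Δ ∅} {one₂} unit (a , b)

  coassoc-empty : ∀ π → IsEmpty π → (Δ ⊗id) (Δ π) ≈₃ (id⊗ Δ) (Δ π)
  coassoc-empty π ex = begin
    (Δ ⊗id) (Δ π)  ≈⟨ ⊗id-cong (Δ π) one₂ (Δ-empty π ex) ⟩
    (Δ ⊗id) one₂   ≈⟨ coassoc-one ⟩
    (id⊗ Δ) one₂   ≈⟨ id⊗-cong (Δ π) one₂ (Δ-empty π ex) ⟨
    (id⊗ Δ) (Δ π)  ∎
    where open ≈₃-Reasoning

  LeftCutAt RightCutAt : Cols → Diagram → Diagram → Diagram → ℕ → Set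
  LeftCutAt cs a b d j = ValidCut j cs × (fromCols (drop j cs) ≈D d) × GenPair (fromCols (take j cs)) a b
  RightCutAt cs a b d i = ValidCut i cs × (fromCols (take i cs) ≈D a) × GenPair (fromCols (drop i cs)) b d

  LeftCutAt? : ∀ cs a b d j → Dec (LeftCutAt cs a b d j)
  LeftCutAt? cs a b d j = ValidCut? j cs ×-dec (fromCols (drop j cs) ≈D? d) ×-dec GenPair? (fromCols (take j cs)) a b
  RightCutAt? : ∀ cs a b d j → Dec (RightCutAt cs a b d j)
  RightCutAt? cs a b d j = ValidCut? j cs ×-dec (fromCols (take j cs) ≈D? a) ×-dec GenPair? (fromCols (drop j cs)) b d

  EmptyOrIrred-fromCols : ∀ T → NoSplit T → EmptyOrIrred (fromCols T)
  EmptyOrIrred-fromCols T n = NoSplit⇒EmptyOrIrred (fromCols T) (Eq.subst NoSplit (Eq.sym (cols-fromCols T)) n)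

  leftTerm : ∀ cs a b d j (dc : Dec (ValidCut j cs)) →
    χ (does dc) (1# * χ (fromCols (drop j cs) ≈Dᵇ d) (C₂.coeff (Δ (fromCols (take j cs))) (a , b))) ≈
    χ (does dc ∧ ((fromCols (drop j cs) ≈Dᵇ d) ∧ does (GenPair? (fromCols (take j cs)) a b))) 1#
  leftTerm cs a b d j (no _) = refl
  leftTerm cs a b d j (yes (gl , nT , nD)) =
    trans (*-identityˡ _) (trans (χ-cong (fromCols (drop j cs) ≈Dᵇ d) (coeff-Δ-generator (fromCols (take j cs)) (EmptyOrIrred-fromCols _ nT) a b))
      (χ-∧ (fromCols (drop j cs) ≈Dᵇ d) _ 1#))

  rightTerm : ∀ cs a b d j (dc : Dec (ValidCut j cs)) →
    χ (does dc) (1# * χ (fromCols (take j cs) ≈Dᵇ a) (C₂.coeff (Δ (fromCols (drop j cs))) (b , d))) ≈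
    χ (does dc ∧ ((fromCols (take j cs) ≈Dᵇ a) ∧ does (GenPair? (fromCols (drop j cs)) b d))) 1#
  rightTerm cs a b d j (no _) = refl
  rightTerm cs a b d j (yes (gl , nT , nD)) =
    trans (*-identityˡ _) (trans (χ-cong (fromCols (take j cs) ≈Dᵇ a) (coeff-Δ-generator (fromCols (drop j cs)) (EmptyOrIrred-fromCols _ nD) b d))
      (χ-∧ (fromCols (take j cs) ≈Dᵇ a) _ 1#))

  coeff-⊗id-cutSum : ∀ cs a b d → C₃.coeff ((Δ ⊗id) (cutSum cs)) (a , b , d) ≈ count (LeftCutAt? cs a b d) (suc (length cs))
  coeff-⊗id-cutSum cs a b d = trans (coeff-⊗id (cutSum cs) a b d) (trans (∑-concatMap (cutTerm cs) (downFrom (suc (length cs))) h)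
    (∑-cong (downFrom (suc (length cs))) λ j → trans (∑-if (does (ValidCut? j cs)) (1# , fromCols (take j cs) , fromCols (drop j cs)) h)
      (leftTerm cs a b d j (ValidCut? j cs))))
    where h : Carrier × D² → Carrier
          h e = proj₁ e * χ (proj₂ (proj₂ e) ≈Dᵇ d) (C₂.coeff (Δ (proj₁ (proj₂ e))) (a , b))

  coeff-id⊗-cutSum : ∀ cs a b d → C₃.coeff ((id⊗ Δ) (cutSum cs)) (a , b , d) ≈ count (RightCutAt? cs a b d) (suc (length cs))
  coeff-id⊗-cutSum cs a b d = trans (coeff-id⊗ (cutSum cs) a b d) (trans (∑-concatMap (cutTerm cs) (downFrom (suc (length cs))) h)
    (∑-cong (downFrom (suc (length cs))) λ j → trans (∑-if (does (ValidCut? j cs)) (1# , fromCols (take j cs) , fromCols (drop j cs)) h)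
      (rightTerm cs a b d j (ValidCut? j cs))))
    where h : Carrier × D² → Carrier
          h e = proj₁ e * χ (proj₁ (proj₂ e) ≈Dᵇ a) (C₂.coeff (Δ (proj₂ (proj₂ e))) (b , d))

  LeftCutAt-unique : ∀ cs a b d j → j < suc (length cs) → LeftCutAt cs a b d j → j Eq.≡ ∣ a ∣ +ℕ ∣ b ∣
  LeftCutAt-unique cs a b d j jl (_ , _ , gt) =
    Eq.sym (Eq.trans (proj₁ (proj₂ (proj₂ (GenPair⇒CutPair (fromCols (take j cs)) a b gt))))
            (Eq.trans (Eq.cong length (cols-fromCols (take j cs))) (length-take< j cs jl)))

  RightCutAt-unique : ∀ cs a b d i → i < suc (length cs) → RightCutAt cs a b d i → i Eq.≡ ∣ a ∣
  RightCutAt-unique cs a b d i il (_ , ea , _) = Eq.trans (Eq.sym (length-take< i cs il)) (Relabel-length (≈D⇒Relabel-fromCols (take i cs) a ea))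

  LeftCutAt⇒LeftCut : ∀ cs a b d j → j < suc (length cs) → LeftCutAt cs a b d j → LeftCut cs a b d
  LeftCutAt⇒LeftCut cs a b d j (s≤s jn) (c , e , gt) =
    j , jn , c , ≈D⇒Relabel-fromCols (drop j cs) d e , Eq.subst (λ Z → CutPair Z a b) (cols-fromCols (take j cs))
        (GenPair⇒CutPair (fromCols (take j cs)) a b gt)

  LeftCut⇒LeftCutAt : ∀ cs a b d → LeftCut cs a b d → Σ ℕ λ j → (j < suc (length cs)) × LeftCutAt cs a b d j
  LeftCut⇒LeftCutAt cs a b d (j , jn , c , r , g) =
    j , s≤s jn , c , Relabel⇒≈D-fromCols (drop j cs) d r , CutPair⇒GenPair (fromCols (take j cs)) a b
        (Eq.subst (λ Z → CutPair Z a b) (Eq.sym (cols-fromCols (take j cs))) g)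

  RightCutAt⇒RightCut : ∀ cs a b d i → i < suc (length cs) → RightCutAt cs a b d i → RightCut cs a b d
  RightCutAt⇒RightCut cs a b d i (s≤s iN) (c , e , gt) =
    i , iN , c , ≈D⇒Relabel-fromCols (take i cs) a e , Eq.subst (λ Z → CutPair Z b d) (cols-fromCols (drop i cs))
        (GenPair⇒CutPair (fromCols (drop i cs)) b d gt)

  RightCut⇒RightCutAt : ∀ cs a b d → RightCut cs a b d → Σ ℕ λ i → (i < suc (length cs)) × RightCutAt cs a b d i
  RightCut⇒RightCutAt cs a b d (i , iN , c , r , g) =
    i , s≤s iN , c , Relabel⇒≈D-fromCols (take i cs) a r , CutPair⇒GenPair (fromCols (drop i cs)) b d
        (Eq.subst (λ Z → CutPair Z b d) (Eq.sym (cols-fromCols (drop i cs))) g)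

  count-left≈count-right : ∀ cs a b d → count (LeftCutAt? cs a b d) (suc (length cs)) ≈ count (RightCutAt? cs a b d) (suc (length cs))
  count-left≈count-right cs a b d = begin
    count (LeftCutAt? cs a b d) N                     ≈⟨ count-anyUpTo? (LeftCutAt? cs a b d) N uniqueL ⟩
    χ (does (anyUpTo? (LeftCutAt? cs a b d) N)) 1#    ≡⟨ Eq.cong (λ b → χ b 1#)
        (does-⇔ (mk⇔ l⇒r r⇒l) (anyUpTo? (LeftCutAt? cs a b d) N) (anyUpTo? (RightCutAt? cs a b d) N)) ⟩
    χ (does (anyUpTo? (RightCutAt? cs a b d) N)) 1#   ≈⟨ count-anyUpTo? (RightCutAt? cs a b d) N uniqueR ⟨
    count (RightCutAt? cs a b d) N                    ∎
    where
    open ≈-Reasoning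
    N = suc (length cs)
    uniqueL : ∀ {i j} → i < N → j < N → LeftCutAt cs a b d i → LeftCutAt cs a b d j → i Eq.≡ j
    uniqueL i<N j<N li lj = Eq.trans (LeftCutAt-unique cs a b d _ i<N li) (Eq.sym (LeftCutAt-unique cs a b d _ j<N lj))
    uniqueR : ∀ {i j} → i < N → j < N → RightCutAt cs a b d i → RightCutAt cs a b d j → i Eq.≡ j
    uniqueR i<N j<N ri rj = Eq.trans (RightCutAt-unique cs a b d _ i<N ri) (Eq.sym (RightCutAt-unique cs a b d _ j<N rj))
    l⇒r : (Σ ℕ λ j → j < N × LeftCutAt cs a b d j) → Σ ℕ λ i → i < N × RightCutAt cs a b d i
    l⇒r (j , j<N , l) = RightCut⇒RightCutAt cs a b d (LeftCut⇒RightCut cs a b d (LeftCutAt⇒LeftCut cs a b d j j<N l))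
    r⇒l : (Σ ℕ λ i → i < N × RightCutAt cs a b d i) → Σ ℕ λ j → j < N × LeftCutAt cs a b d j
    r⇒l (i , i<N , r) = LeftCut⇒LeftCutAt cs a b d (RightCut⇒LeftCut cs a b d (RightCutAt⇒RightCut cs a b d i i<N r))

  coassoc-cutSum : ∀ cs → (Δ ⊗id) (cutSum cs) ≈₃ (id⊗ Δ) (cutSum cs)
  coassoc-cutSum cs = ≋⇒≈₃ {(Δ ⊗id) (cutSum cs)} {(id⊗ Δ) (cutSum cs)} λ { (a , b , d) → begin
    C₃.coeff ((Δ ⊗id) (cutSum cs)) (a , b , d)  ≈⟨ coeff-⊗id-cutSum cs a b d ⟩
    count (LeftCutAt? cs a b d) (suc (length cs))   ≈⟨ count-left≈count-right cs a b d ⟩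
    count (RightCutAt? cs a b d) (suc (length cs))  ≈⟨ coeff-id⊗-cutSum cs a b d ⟨
    C₃.coeff ((id⊗ Δ) (cutSum cs)) (a , b , d)  ∎ }
    where open ≈-Reasoning

  coassoc-irreducible : ∀ π → NonEmpty π → Irred π → (Δ ⊗id) (Δ π) ≈₃ (id⊗ Δ) (Δ π)
  coassoc-irreducible π ne irr = begin
    (Δ ⊗id) (Δ π)           ≈⟨ ⊗id-cong (Δ π) (cutSum (cols π)) (Δ≈cutSum π ne irr) ⟩
    (Δ ⊗id) (cutSum (cols π))  ≈⟨ coassoc-cutSum (cols π) ⟩
    (id⊗ Δ) (cutSum (cols π))  ≈⟨ id⊗-cong (Δ π) (cutSum (cols π)) (Δ≈cutSum π ne irr) ⟨
    (id⊗ Δ) (Δ π)           ∎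
    where open ≈₃-Reasoning

  coassoc-order≤ : ∀ n π → order π ≤ n → (Δ ⊗id) (Δ π) ≈₃ (id⊗ Δ) (Δ π)
  coassoc-order≤ zero π le = coassoc-empty π (n≤0⇒n≡0 le)
  coassoc-order≤ (suc m) π le with order π ≟ 0
  ... | yes e = coassoc-empty π e
  ... | no ne with splitPoint? (cols π)
  ...   | no ns = coassoc-irreducible π ne (NoSplit⇒Irred π λ j p q s → ns (j , q , p , s))
  ...   | yes (j , q , p , s) = begin
    (Δ ⊗id) (Δ π)                      ≈⟨ ⊗id-cong (Δ π) (Δ ρ₁ ·₂ Δ ρ₂) eΔ ⟩
    (Δ ⊗id) (Δ ρ₁ ·₂ Δ ρ₂)              ≈⟨ ⊗id-·₂ (Δ ρ₁) (Δ ρ₂) ⟩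
    (Δ ⊗id) (Δ ρ₁) ·₃ (Δ ⊗id) (Δ ρ₂)    ≈⟨ ·₃-congˡ {(Δ ⊗id) (Δ ρ₁)} {(id⊗ Δ) (Δ ρ₁)} ((Δ ⊗id) (Δ ρ₂)) (coassoc-order≤ m ρ₁ o₁) ⟩
    (id⊗ Δ) (Δ ρ₁) ·₃ (Δ ⊗id) (Δ ρ₂)    ≈⟨ ·₃-congʳ ((id⊗ Δ) (Δ ρ₁)) {(Δ ⊗id) (Δ ρ₂)} {(id⊗ Δ) (Δ ρ₂)} (coassoc-order≤ m ρ₂ o₂) ⟩
    (id⊗ Δ) (Δ ρ₁) ·₃ (id⊗ Δ) (Δ ρ₂)    ≈⟨ id⊗-·₂ (Δ ρ₁) (Δ ρ₂) ⟨
    (id⊗ Δ) (Δ ρ₁ ·₂ Δ ρ₂)              ≈⟨ id⊗-cong (Δ π) (Δ ρ₁ ·₂ Δ ρ₂) eΔ ⟨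
    (id⊗ Δ) (Δ π)                      ∎
    where
    open ≈₃-Reasoning
    cs = cols π
    ρ₁ = fromCols (take j cs)
    ρ₂ = fromCols (drop j cs)
    e⊗ : (ρ₁ ⊗ ρ₂) ≈D π
    e⊗ = splitsAt⇒⊗ π j q s
    eΔ : Δ π ≈₂ (Δ ρ₁ ·₂ Δ ρ₂)
    eΔ = ≈₂-trans {Δ π} {Δ (ρ₁ ⊗ ρ₂)} {Δ ρ₁ ·₂ Δ ρ₂} (wellDefined π (ρ₁ ⊗ ρ₂) (≈D-sym {ρ₁ ⊗ ρ₂} {π} e⊗)) (multiplicative ρ₁ ρ₂)
    lcs : length cs ≤ suc m
    lcs = Eq.subst (_≤ suc m) (Eq.sym (length-cols π)) le
    o₁ : order ρ₁ ≤ m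
    o₁ = ≤-pred (≤-trans (length-take<length j cs q) lcs)
    o₂ : order ρ₂ ≤ m
    o₂ = ≤-pred (≤-trans (length-drop<length j cs p (<⇒≤ q)) lcs)

  coassoc-basis : ∀ π → (Δ ⊗id) (Δ π) ≈₃ (id⊗ Δ) (Δ π)
  coassoc-basis π = coassoc-order≤ (order π) π ≤-refl

  eval-linExt : ∀ f x → C₂.eval f (linExt Δ x) ≈ ∑ x (λ e → proj₁ e * C₂.eval f (Δ (proj₂ e)))
  eval-linExt f x = trans (∑-concatMap _ x _) (∑-cong x λ { (r , π) →
    trans (≡⇒≈ (∑-map _ (Δ π) _)) (trans (∑-cong (Δ π) (λ { (r' , y , z) → *-assoc r r' _ })) (∑-* (Δ π) r _)) })

  coassociative : ∀ x → (Δ ⊗id) (linExt Δ x) ≈₃ (id⊗ Δ) (linExt Δ x)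
  coassociative x = ≋⇒≈₃ {(Δ ⊗id) (linExt Δ x)} {(id⊗ Δ) (linExt Δ x)} λ { (a , b , d) → begin
    C₃.coeff ((Δ ⊗id) (linExt Δ x)) (a , b , d)               ≈⟨ coeff-⊗id (linExt Δ x) a b d ⟩
    C₂.eval (⊗id-coeff a b d) (linExt Δ x)                     ≈⟨ eval-linExt (⊗id-coeff a b d) x ⟩
    ∑ x (λ e → proj₁ e * C₂.eval (⊗id-coeff a b d) (Δ (proj₂ e)))  ≈⟨ ∑-cong x (λ e → *-cong refl (on-basis (proj₂ e) a b d)) ⟩
    ∑ x (λ e → proj₁ e * C₂.eval (id⊗-coeff a b d) (Δ (proj₂ e)))  ≈⟨ eval-linExt (id⊗-coeff a b d) x ⟨
    C₂.eval (id⊗-coeff a b d) (linExt Δ x)                     ≈⟨ coeff-id⊗ (linExt Δ x) a b d ⟨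
    C₃.coeff ((id⊗ Δ) (linExt Δ x)) (a , b , d)               ∎ }
    where
    open ≈-Reasoning
    on-basis : ∀ π a b d → C₂.eval (⊗id-coeff a b d) (Δ π) ≈ C₂.eval (id⊗-coeff a b d) (Δ π)
    on-basis π a b d = trans (sym (coeff-⊗id (Δ π) a b d))
      (trans (≈₃⇒≋ {(Δ ⊗id) (Δ π)} {(id⊗ Δ) (Δ π)} (coassoc-basis π) (a , b , d)) (coeff-id⊗ (Δ π) a b d))


module Existence {c ℓ} (F : Field c ℓ) where

  open import Data.List using ([]; _∷_; _++_; map)
  open import Data.List.Properties using (map-++)
  open import Data.List.Relation.Unary.All using (All; []; _∷_)
  open import Data.List.Relation.Binary.Pointwise using (Pointwise; []; _∷_)
  import Data.List.Relation.Unary.All as All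
  open import Data.Product using (_×_; _,_)
  open import Relation.Nullary using (¬_; does)
  open import Function using (_∘_)
  import Relation.Binary.PropositionalEquality as Eq
  open ColumnForm
  open Occurrence
  open ColumnsOfProducts
  open ProductLaws
  open Factorisation
  open Tensors F
  open CutCoproduct F

  cutSum-Relabel : ∀ {T T'} → Relabel T T' → cutSum T ≈₂ cutSum T'
  cutSum-Relabel {T} {T'} r = ≋⇒≈₂ {cutSum T} {cutSum T'} λ { (a , b) →
    trans (coeff-cutSum-χ T a b) (trans (≡⇒≈ (Eq.cong (λ bb → χ bb 1#)
              (does-⇔ (mk⇔ (CutPair-Relabel a b r) (CutPair-Relabel a b (Relabel-sym r))) (CutPair? T a b) (CutPair? T' a b))))
      (sym (coeff-cutSum-χ T' a b))) }

  cutSums-map² : ∀ f Fs → All (λ T → Relabel T (map² f T)) Fs → Pointwise _≈₂_ (map cutSum (map (map² f) Fs)) (map cutSum Fs)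
  cutSums-map² f [] [] = []
  cutSums-map² f (T ∷ Fs) (r ∷ rs) = cutSum-Relabel (Relabel-sym r) ∷ cutSums-map² f Fs rs

  Δ₀ : Diagram → ParSym⊗²
  Δ₀ π = product₂ (map cutSum (factors [] (cols π)))

  Δ₀-Relabel : ∀ X Y → Relabel X Y → product₂ (map cutSum (factors [] Y)) ≈₂ product₂ (map cutSum (factors [] X))
  Δ₀-Relabel X Y r@(f , g , e1 , e2) =
    Eq.subst (λ Z → product₂ (map cutSum Z) ≈₂ product₂ (map cutSum (factors [] X)))
      (Eq.trans (Eq.sym (factors-map² f [] X (Relabel-injective r))) (Eq.cong (factors []) e1))
      (product₂-cong (cutSums-map² f (factors [] X) (All.map (λ {T} sub → f , g , Eq.refl ,
          Eq.trans (map²-map² g f T) (Eq.trans (map²-cong-In T (λ i → LeftInverseOn-In {f} {g} X (Relabel⇒LeftInverseOn r) (sub i))) (map²-id T)))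
        (factors-⊆ [] X))))

  factors-⊗ᶜ : ∀ c₁ c₂ → factors [] (c₁ ⊗ᶜ c₂) Eq.≡ map (map² ev) (factors [] c₁) ++ map (map² od) (factors [] c₂)
  factors-⊗ᶜ c₁ c₂ = Eq.trans (factors-++ (map² ev c₁) (map² od c₂) (Disjoint-images c₁ c₂ ev≢od))
    (Eq.cong₂ _++_ (factors-map² ev [] c₁ (λ _ _ → ev-inj)) (factors-map² od [] c₂ (λ _ _ → od-inj)))

  Δ₀-wellDefined : ∀ π ρ → π ≈D ρ → Δ₀ π ≈₂ Δ₀ ρ
  Δ₀-wellDefined π ρ π≈ρ = ≈₂-sym {Δ₀ ρ} {Δ₀ π} (Δ₀-Relabel (cols π) (cols ρ) (≈D⇒Relabel {π} {ρ} π≈ρ))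

  Δ₀-multiplicative : ∀ π ρ → Δ₀ (π ⊗ ρ) ≈₂ (Δ₀ π ·₂ Δ₀ ρ)
  Δ₀-multiplicative π ρ = begin
    Δ₀ (π ⊗ ρ)                                     ≡⟨ Eq.cong (product₂ ∘ map cutSum) factors-cols-⊗ ⟩
    product₂ (map cutSum (A ++ B))                 ≡⟨ Eq.cong product₂ (map-++ cutSum A B) ⟩
    product₂ (map cutSum A ++ map cutSum B)        ≈⟨ product₂-++ (map cutSum A) (map cutSum B) ⟩
    product₂ (map cutSum A) ·₂ product₂ (map cutSum B)
      ≈⟨ ·₂-congˡ {product₂ (map cutSum A)} {Δ₀ π} _
          (product₂-cong (cutSums-map² ev (factors [] (cols π)) (All.tabulate (λ {T} _ → Relabel-ev T)))) ⟩
    Δ₀ π ·₂ product₂ (map cutSum B)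
      ≈⟨ ·₂-congʳ (Δ₀ π) {product₂ (map cutSum B)} {Δ₀ ρ}
          (product₂-cong (cutSums-map² od (factors [] (cols ρ)) (All.tabulate (λ {T} _ → Relabel-od T)))) ⟩
    Δ₀ π ·₂ Δ₀ ρ                                   ∎
    where
    open ≈₂-Reasoning
    A = map (map² ev) (factors [] (cols π))
    B = map (map² od) (factors [] (cols ρ))
    factors-cols-⊗ : factors [] (cols (π ⊗ ρ)) Eq.≡ A ++ B
    factors-cols-⊗ = Eq.trans (Eq.cong (factors []) (cols-⊗ π ρ)) (factors-⊗ᶜ (cols π) (cols ρ))

  Δ₀-irreducible : ∀ π → NonEmpty π → Irred π → Δ₀ π ≈₂ cutSum (cols π)
  Δ₀-irreducible π ne irr rewrite factors-irreducible π ne irr = ·₂-identityʳ (cutSum (cols π))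

  Δ₀-onGenerators : ∀ π → NonEmpty π → Irred π → ∀ G₁ G₂ →
                    (GenTerm π G₁ G₂ → coeff₂ (Δ₀ π) G₁ G₂ ≈ 1#) × (¬ GenTerm π G₁ G₂ → coeff₂ (Δ₀ π) G₁ G₂ ≈ 0#)
  Δ₀-onGenerators π ne irr a b =
    (λ g → trans coeff-Δ₀ (χ-does-yes (CutPair? (cols π) a b) (GenPair⇒CutPair π a b g))) ,
    (λ ¬g → trans coeff-Δ₀ (χ-does-no (CutPair? (cols π) a b) (λ p → ¬g (CutPair⇒GenPair π a b p))))
    where
    coeff-Δ₀ : coeff₂ (Δ₀ π) a b ≈ χ (does (CutPair? (cols π) a b)) 1#
    coeff-Δ₀ = trans (Δ₀-irreducible π ne irr a b)
                 (trans (≡⇒≈ (coeff₂≡coeff (cutSum (cols π)) a b)) (coeff-cutSum-χ (cols π) a b))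

  Δ₀-isCoproduct : IsCoproduct Δ₀
  Δ₀-isCoproduct = record
    { wellDefined = Δ₀-wellDefined
    ; unit = ≈₂-refl {one₂}
    ; multiplicative = Δ₀-multiplicative
    ; onGenerators = Δ₀-onGenerators
    }


theorem3p7 : ∀ {c ℓ} (F : Field c ℓ) → let open ParSymOver F in
  Σ (Diagram → ParSym⊗²) IsCoproduct
  × (∀ (Δ : Diagram → ParSym⊗²) → IsCoproduct Δ →
       ∀ (x : ParSym) → (Δ ⊗id) (linExt Δ x) ≈₃ (id⊗ Δ) (linExt Δ x))
theorem3p7 F = (Existence.Δ₀ F , Existence.Δ₀-isCoproduct F) , Coassociativity.coassociative F
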